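{- Let $T$ and $T'$ be two proper caterpillars with the same $U$-polynomial, $U_T=U_{T'}$. Then for any $\beta\in\Phi(T)$ and $\beta'\in\Phi(T')$ we have $\mathcal{L}(\beta,\mathbf{x})=\mathcal{L}(\beta',\mathbf{x})$.
   Context: For a tree $T=(V,E)$ and $A\subseteq E$, $\lambda(A)$ is the partition of $|V|$ given by the component sizes of the spanning subgraph $(V,A)$; with $\mathbf{x}_\lambda=x_{\lambda_1}\cdots x_{\lambda_l}$, the $U$-polynomial of a tree is $U_T(\mathbf{x})=\sum_{A\subseteq E}\mathbf{x}_{\lambda(A)}$. A composition is a finite sequence of positive integers; $\alpha\succeq\beta$ ($\alpha$ is a coarsening of $\beta$) if $\alpha$ is obtained from $\beta$ by summing blocks of consecutive components; $\lambda(\alpha)$ is the partition obtained by sorting the components of $\alpha$ decreasingly; $\mathcal{L}(\beta,\mathbf{x})=\sum_{\alpha\succeq\beta}\mathbf{x}_{\lambda(\alpha)}$. A caterpillar is a tree whose internal vertices induce a non-trivial path (the spine); it is proper if every internal vertex is adjacent to a leaf. For a proper caterpillar with spine $v_1\cdots v_k$, $\Phi(T)=\{\beta,\text{reverse of }\beta\}$ where $\beta=\beta_1\cdots\beta_k$ and $\beta_i$ is one plus the number of leaves adjacent to $v_i$. -}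

module Defs where

open import Data.Nat using (ℕ; zero; suc; _+_; _≤_; _<_)
open import Data.Fin using (Fin; toℕ)
import Data.Fin as F
open import Data.Bool using (Bool; true; false; _∨_; _∧_; not; if_then_else_)
open import Data.List using (List; []; _∷_; map; length; allFin; concatMap; _++_)
open import Data.Bool.ListAction using (any)
open import Data.List.Membership.Propositional using (_∈_)
open import Data.List.Relation.Unary.AllPairs using (AllPairs)
open import Data.List.Relation.Unary.All using (All)
open import Data.Product using (Σ; _×_; _,_; ∃-syntax; proj₁; proj₂)
open import Data.Sum using (_⊎_)
open import Relation.Nullary using (¬_; ⌊_⌋)
open import Relation.Binary.PropositionalEquality using (_≡_)
open import Function.Bundles using (_⇔_)
open import Data.List.Relation.Binary.Permutation.Propositional using (↭-setoid)
import Data.List.Relation.Binary.Permutation.Setoid as PermS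

-- Polynomials in the commuting variables x₁, x₂, … with ℕ coefficients.
-- A monomial x_λ = x_{λ₁}⋯x_{λₗ} is represented by the list of its
-- indices (a multiset: order irrelevant); a polynomial by the formal sum
-- (list) of its monomials, each with coefficient one.
-- Two such polynomials are equal iff their lists of monomials are
-- permutations of each other, where monomials are compared as
-- multisets (permutation of index lists).

Monomial : Set
Monomial = List ℕ

Poly : Set
Poly = List Monomial

_≈P_ : Poly → Poly → Set
_≈P_ = PermS._↭_ (↭-setoid {A = ℕ})

-- Graphs on vertex set Fin n, edge set a list of (unordered) edges.

Edge : ℕ → Set
Edge n = Fin n × Fin n

_==_ : ∀ {n} → Fin n → Fin n → Bool
u == v = ⌊ u F.≟ v ⌋

joins : ∀ {n} → Edge n → Fin n → Fin n → Bool
joins (a , b) u v = (a == u ∧ b == v) ∨ (a == v ∧ b == u)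

adjB : ∀ {n} → List (Edge n) → Fin n → Fin n → Bool
adjB E u v = any (λ e → joins e u v) E

Adj : ∀ {n} → List (Edge n) → Fin n → Fin n → Set
Adj E u v = adjB E u v ≡ true

count : ∀ {A : Set} → (A → Bool) → List A → ℕ
count p []       = 0
count p (x ∷ xs) = if p x then suc (count p xs) else count p xs

keep : ∀ {A : Set} → (A → Bool) → List A → List A
keep p []       = []
keep p (x ∷ xs) = if p x then x ∷ keep p xs else keep p xs

data Walk {n} (E : List (Edge n)) : Fin n → Fin n → Set where
  here : ∀ {u} → Walk E u u
  step : ∀ {u w v} → Adj E u w → Walk E w v → Walk E u v

record IsTree (n : ℕ) (E : List (Edge n)) : Set where
  field
    noLoops     : All (λ e → ¬ (proj₁ e ≡ proj₂ e)) E
    noMultiEdge : AllPairs (λ e f → joins e (proj₁ f) (proj₂ f) ≡ false) E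
    connected   : ∀ u v → Walk E u v
    edgeCount   : suc (length E) ≡ n

closeStep : ∀ {n} → List (Edge n) → (Fin n → Bool) → (Fin n → Bool)
closeStep {n} A S v = S v ∨ any (λ u → S u ∧ adjB A u v) (allFin n)

iter : ∀ {X : Set} → ℕ → (X → X) → X → X
iter zero    f x = x
iter (suc k) f x = f (iter k f x)

-- the vertex set of the component of v in (V, A) (n rounds suffice)
comp : ∀ {n} → List (Edge n) → Fin n → (Fin n → Bool)
comp {n} A v = iter n (closeStep A) (λ u → u == v)

isRep : ∀ {n} → List (Edge n) → Fin n → Bool
isRep {n} A v = not (any (λ u → comp A v u ∧ ⌊ toℕ u Data.Nat.<? toℕ v ⌋) (allFin n))
  where import Data.Nat

partitionOf : ∀ {n} → List (Edge n) → Monomial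
partitionOf {n} A = map (λ v → count (comp A v) (allFin n)) (keep (isRep A) (allFin n))

subsets : ∀ {X : Set} → List X → List (List X)
subsets []       = [] ∷ []
subsets (x ∷ xs) = let s = subsets xs in map (x ∷_) s ++ s

U : ∀ {n} → List (Edge n) → Poly
U E = map partitionOf (subsets E)

-- all coarsenings α ⪰ β (each exactly once): each gap between consecutive
-- components of β is either kept or merged
coarsenings : List ℕ → List (List ℕ)
coarsenings []       = [] ∷ []
coarsenings (b ∷ bs) = concatMap ext (coarsenings bs)
  where
  ext : List ℕ → List (List ℕ)
  ext []       = (b ∷ []) ∷ []
  ext (a ∷ as) = (b ∷ a ∷ as) ∷ ((b + a) ∷ as) ∷ []

-- L(β, x) = Σ_{α ⪰ β} x_{λ(α)}   (x_{λ(α)} is the multiset of parts of α)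
Lpoly : List ℕ → Poly
Lpoly β = coarsenings β

degree : ∀ {n} → List (Edge n) → Fin n → ℕ
degree {n} E v = count (adjB E v) (allFin n)

Leaf : ∀ {n} → List (Edge n) → Fin n → Set
Leaf E v = degree E v ≡ 1

Internal : ∀ {n} → List (Edge n) → Fin n → Set
Internal E v = 2 ≤ degree E v

data IsPath {n} (E : List (Edge n)) : List (Fin n) → Set where
  nil  : IsPath E []
  one  : ∀ v → IsPath E (v ∷ [])
  cons : ∀ {u v vs} → Adj E u v → IsPath E (v ∷ vs) → IsPath E (u ∷ v ∷ vs)

record IsSpine {n} (E : List (Edge n)) (vs : List (Fin n)) : Set where
  field
    nontrivial : 2 ≤ length vs
    distinct   : AllPairs (λ u v → ¬ (u ≡ v)) vs
    path       : IsPath E vs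
    internal   : ∀ v → (v ∈ vs) ⇔ Internal E v

Caterpillar : ∀ {n} → List (Edge n) → Set
Caterpillar {n} E = IsTree n E × Σ (List (Fin n)) (IsSpine E)

ProperCaterpillar : ∀ {n} → List (Edge n) → Set
ProperCaterpillar {n} E =
  Caterpillar E × (∀ v → Internal E v → ∃[ u ] (Leaf E u × Adj E v u))

leafB : ∀ {n} → List (Edge n) → Fin n → Bool
leafB E v = ⌊ degree E v Data.Nat.≟ 1 ⌋
  where import Data.Nat

-- β read off a spine v₁⋯v_k : β_i = 1 + #leaves adjacent to v_i.
-- Φ(T) = { spineComp E vs | vs a spine of T }  (= {β, reverse β}).
spineComp : ∀ {n} → List (Edge n) → List (Fin n) → List ℕ
spineComp {n} E vs = map (λ v → suc (count (λ u → leafB E u ∧ adjB E v u) (allFin n))) vs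

Φ : ∀ {n} → List (Edge n) → List ℕ → Set
Φ {n} E β = ∃[ vs ] (IsSpine E vs × β ≡ spineComp E vs)

module Submission where

-- Let T be a proper caterpillar with spine v₁ ⋯ v_k and let
-- β = β₁ ⋯ β_k be read off the spine.  We show that the part of U_T
-- consisting of the monomials without a factor x₁ is exactly L(β):
--
--   * the edges of T are the k − 1 spine edges vᵢvᵢ₊₁ together with one
--     edge for every leaf (a counting argument: a tree has n − 1 edges);
--   * if A ⊆ E omits the edge of some leaf, that leaf is an isolated
--     vertex of (V, A), so x_{λ(A)} contains x₁;
--   * if A contains every leaf edge, and the spine edges of A are described
--     by a choice vector c (cᵢ = true iff vᵢvᵢ₊₁ ∈ A), the components of
--     (V, A) are the maximal runs of merged spine vertices together with
--     their leaves, so λ(A) is the coarsening of β selected by c.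
--
-- Filtering out the monomials containing x₁ respects equality of
-- polynomials, so U_T = U_T' gives L(β) = L(β').  Reversal of β is
-- covered because Φ(T) is defined by all spines of T.

open import Defs
open import Data.Nat using (ℕ; zero; suc; _+_; _≤_; _<_; _∸_; z≤n; s≤s; _≡ᵇ_; _<?_)
open import Data.Nat.Properties
open import Data.Fin using (Fin; toℕ)
import Data.Fin as F
open import Data.Fin.Properties using (toℕ-injective)
open import Data.Bool using (Bool; true; false; _∨_; _∧_; not; if_then_else_; T)
open import Data.Bool.Properties using (∨-zeroʳ; ∨-identityʳ; ∨-assoc; ∨-comm; not-involutive)
open import Algebra.Properties.CommutativeSemigroup +-commutativeSemigroup using (interchange)
open import Data.Bool.ListAction using (any)
open import Data.List using (List; []; _∷_; map; length; _++_; concatMap; allFin; upTo; applyUpTo; filter)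
open import Data.List.Properties
  using (map-++; map-∘; map-cong; map-id; ++-assoc; ++-identityʳ; concatMap-++; length-map; length-tabulate; length-++;
         map-applyUpTo; filter-++; filter-accept; filter-none)
open import Data.List.Membership.Propositional using (_∈_; _∉_)
open import Data.List.Membership.Propositional.Properties
  using (∈-∃++; ∈-allFin; ∈-upTo⁺; ∈-upTo⁻; ∈-map⁺; ∈-map⁻; ∈-++⁺ˡ; ∈-++⁺ʳ; ∈-++⁻)
open import Data.List.Membership.DecPropositional _≟_ using () renaming (_∈?_ to _∈ℕ?_)
open import Data.List.Membership.Propositional.Properties.WithK using (unique∧set⇒bag)
open import Data.List.Relation.Unary.Any using (here; there)
open import Data.List.Relation.Unary.All using (All; []; _∷_)
import Data.List.Relation.Unary.All as All
open import Data.List.Relation.Unary.AllPairs using (AllPairs; []; _∷_)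
import Data.List.Relation.Unary.AllPairs as AllPairs
open import Data.List.Relation.Unary.Unique.Propositional using (Unique)
open import Data.List.Relation.Unary.Unique.Propositional.Properties using (upTo⁺; allFin⁺)
open import Data.List.Relation.Binary.BagAndSetEquality using (∼bag⇒↭)
open import Data.List.Relation.Binary.Permutation.Propositional
  using (_↭_; prep; swap; ↭-sym; ↭-trans; ↭-refl; ↭-reflexive; ↭-setoid; ↭-isEquivalence; ↭⇒↭ₛ′)
import Data.List.Relation.Binary.Permutation.Propositional as Perm
open import Data.List.Relation.Binary.Permutation.Propositional.Properties
  using (shift; ++-comm; ++⁺ˡ; ++⁺ʳ; ++⁺; map⁺; ↭-length; ∈-resp-↭)
import Data.List.Relation.Binary.Permutation.Setoid as PermS
import Data.List.Relation.Binary.Permutation.Setoid.Properties as PermSP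
open import Data.List.Relation.Binary.Pointwise using (Pointwise; []; _∷_)
open import Data.Product using (_×_; _,_; ∃-syntax; proj₁; proj₂)
open import Data.Product.Properties using (≡-dec)
open import Data.Sum using (_⊎_; inj₁; inj₂)
open import Data.Empty using (⊥; ⊥-elim)
open import Data.Unit using (⊤)
open import Relation.Nullary using (¬_; Dec; yes; no; ⌊_⌋; ¬?)
open import Relation.Binary.PropositionalEquality
open import Function using (_∘_)
open import Function.Bundles using (Equivalence; mk⇔)

private variable
  X Y : Set

t≢f : true ≡ false → ⊥
t≢f ()

not-true : ∀ b → ¬ b ≡ true → b ≡ false
not-true true  h = ⊥-elim (h refl)
not-true false h = refl

∨-true : ∀ a b → a ∨ b ≡ true → a ≡ true ⊎ b ≡ true
∨-true true  b e = inj₁ refl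
∨-true false b e = inj₂ e

∧-true : ∀ a b → a ∧ b ≡ true → a ≡ true × b ≡ true
∧-true true true e = refl , refl

any-∈ : (p : X → Bool) (xs : List X) → any p xs ≡ true → ∃[ x ] (x ∈ xs × p x ≡ true)
any-∈ p (x ∷ xs) e with p x in px
... | true  = x , here refl , px
... | false = let y , y∈ , py = any-∈ p xs e in y , there y∈ , py

∈-any : (p : X → Bool) {xs : List X} {x : X} → x ∈ xs → p x ≡ true → any p xs ≡ true
∈-any p {x ∷ xs} (here refl) px rewrite px = refl
∈-any p {x ∷ xs} (there m)   px with p x
... | true  = refl
... | false = ∈-any p m px

any-false : (p : X → Bool) (xs : List X) → (∀ x → x ∈ xs → p x ≡ false) → any p xs ≡ false
any-false p []       h = refl
any-false p (x ∷ xs) h rewrite h x (here refl) = any-false p xs (λ y m → h y (there m))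

any-cong : (p q : X → Bool) (xs : List X) → (∀ x → p x ≡ q x) → any p xs ≡ any q xs
any-cong p q []       h = refl
any-cong p q (x ∷ xs) h rewrite h x | any-cong p q xs h = refl

any-↭ : (p : X → Bool) {xs ys : List X} → xs ↭ ys → any p xs ≡ any p ys
any-↭ p Perm.refl        = refl
any-↭ p (Perm.prep x r)  = cong (p x ∨_) (any-↭ p r)
any-↭ p {x ∷ y ∷ xs} {.y ∷ .x ∷ ys} (Perm.swap x y r) = begin
  p x ∨ (p y ∨ any p xs)  ≡⟨ sym (∨-assoc (p x) (p y) (any p xs)) ⟩
  (p x ∨ p y) ∨ any p xs  ≡⟨ cong (_∨ any p xs) (∨-comm (p x) (p y)) ⟩
  (p y ∨ p x) ∨ any p xs  ≡⟨ ∨-assoc (p y) (p x) (any p xs) ⟩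
  p y ∨ (p x ∨ any p xs)  ≡⟨ cong (λ z → p y ∨ (p x ∨ z)) (any-↭ p r) ⟩
  p y ∨ (p x ∨ any p ys)  ∎
  where open ≡-Reasoning
any-↭ p (Perm.trans r s) = trans (any-↭ p r) (any-↭ p s)

count-cong : (p q : X → Bool) (xs : List X) → (∀ x → x ∈ xs → p x ≡ q x) → count p xs ≡ count q xs
count-cong p q []       h = refl
count-cong p q (x ∷ xs) h rewrite h x (here refl) with q x
... | true  = cong suc (count-cong p q xs (λ y m → h y (there m)))
... | false = count-cong p q xs (λ y m → h y (there m))

count-split : (p : X → Bool) (xs : List X) → count p xs + count (λ x → not (p x)) xs ≡ length xs
count-split p []       = refl
count-split p (x ∷ xs) with p x
... | true  = cong suc (count-split p xs)
... | false = trans (+-suc _ _) (cong suc (count-split p xs))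

count-keep : (p : X → Bool) (xs : List X) → length (keep p xs) ≡ count p xs
count-keep p []       = refl
count-keep p (x ∷ xs) with p x
... | true  = cong suc (count-keep p xs)
... | false = count-keep p xs

count-or : (p q : X → Bool) (xs : List X) → (∀ x → p x ∧ q x ≡ false) →
           count (λ x → p x ∨ q x) xs ≡ count p xs + count q xs
count-or p q []       h = refl
count-or p q (x ∷ xs) h with p x in px | q x in qx
... | true  | true  = ⊥-elim (t≢f (trans (sym (cong₂ _∧_ px qx)) (h x)))
... | true  | false = cong suc (count-or p q xs h)
... | false | true  = trans (cong suc (count-or p q xs h)) (sym (+-suc _ _))
... | false | false = count-or p q xs h

count-pos : (p : X → Bool) {xs : List X} {x : X} → x ∈ xs → p x ≡ true → 1 ≤ count p xs
count-pos p {y ∷ xs} (here refl) px rewrite px = s≤s z≤n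
count-pos p {y ∷ xs} (there m)   px with p y
... | true  = s≤s z≤n
... | false = count-pos p m px

count-two : (p : X → Bool) {xs : List X} {x y : X} → x ∈ xs → y ∈ xs → ¬ x ≡ y →
            p x ≡ true → p y ≡ true → 2 ≤ count p xs
count-two p (here refl) (here refl) ne px py = ⊥-elim (ne refl)
count-two p (here refl) (there my)  ne px py rewrite px = s≤s (count-pos p my py)
count-two p {z ∷ _} (there mx) (here refl) ne px py rewrite py = s≤s (count-pos p mx px)
count-two p {z ∷ _} (there mx) (there my) ne px py with p z
... | true  = m≤n⇒m≤1+n (count-two p mx my ne px py)
... | false = count-two p mx my ne px py

count-zero : (p : X → Bool) (xs : List X) → (∀ x → x ∈ xs → p x ≡ false) → count p xs ≡ 0
count-zero p []       h = refl
count-zero p (x ∷ xs) h rewrite h x (here refl) = count-zero p xs (λ y m → h y (there m))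

count-single : (p : X → Bool) {xs : List X} {x : X} → Unique xs → x ∈ xs → p x ≡ true →
               (∀ y → y ∈ xs → p y ≡ true → y ≡ x) → count p xs ≡ 1
count-single p {z ∷ xs} (a ∷ u) (here refl) px h rewrite px =
  cong suc (count-zero p xs λ y m → not-true (p y) λ py → All.lookup a m (sym (h y (there m) py)))
count-single p {z ∷ xs} (a ∷ u) (there mx) px h with p z in pz
... | true  = ⊥-elim (All.lookup a mx (h z (here refl) pz))
... | false = count-single p u mx px (λ y m py → h y (there m) py)

∈-keep⁺ : (p : X → Bool) {xs : List X} {x : X} → x ∈ xs → p x ≡ true → x ∈ keep p xs
∈-keep⁺ p {y ∷ xs} (here refl) px rewrite px = here refl
∈-keep⁺ p {y ∷ xs} (there m)   px with p y
... | true  = there (∈-keep⁺ p m px)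
... | false = ∈-keep⁺ p m px

∈-keep⁻ : (p : X → Bool) (xs : List X) {x : X} → x ∈ keep p xs → x ∈ xs × p x ≡ true
∈-keep⁻ p (y ∷ xs) m with p y in py
∈-keep⁻ p (y ∷ xs) (here refl) | true = here refl , py
∈-keep⁻ p (y ∷ xs) (there m)   | true = let a , b = ∈-keep⁻ p xs m in there a , b
... | false = let a , b = ∈-keep⁻ p xs m in there a , b

keep-unique : (p : X → Bool) (xs : List X) → Unique xs → Unique (keep p xs)
keep-unique p []       u = []
keep-unique p (x ∷ xs) (a ∷ u) with p x
... | true  = keep-all a ∷ keep-unique p xs u
  where
  keep-all : ∀ {ys} → All (λ y → ¬ x ≡ y) ys → All (λ y → ¬ x ≡ y) (keep p ys)
  keep-all {ys} a = All.tabulate λ m → All.lookup a (proj₁ (∈-keep⁻ p ys m))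
... | false = keep-unique p xs u

keep-↭ : (p : X → Bool) (xs : List X) → keep p xs ++ keep (λ x → not (p x)) xs ↭ xs
keep-↭ p []       = ↭-refl
keep-↭ p (x ∷ xs) with p x
... | true  = prep x (keep-↭ p xs)
... | false = ↭-trans (shift x (keep p xs) (keep _ xs)) (prep x (keep-↭ p xs))

-- The spine and leaf edges are identified with
-- sublists of E by counting, so we need that a duplicate-free list
-- contained in another is no longer, and that two duplicate-free lists
-- with the same members are permutations of each other.

∈-mid⁻ : (as bs : List X) {x y : X} → y ∈ as ++ x ∷ bs → ¬ y ≡ x → y ∈ as ++ bs
∈-mid⁻ []       bs (here refl) ne = ⊥-elim (ne refl)
∈-mid⁻ []       bs (there m)   ne = m
∈-mid⁻ (a ∷ as) bs (here refl) ne = here refl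
∈-mid⁻ (a ∷ as) bs (there m)   ne = there (∈-mid⁻ as bs m ne)

unique-⊆-length : (xs ys : List X) → Unique xs → (∀ x → x ∈ xs → x ∈ ys) → length xs ≤ length ys
unique-⊆-length []       ys u h = z≤n
unique-⊆-length (x ∷ xs) ys (a ∷ u) h with ∈-∃++ (h x (here refl))
... | as , bs , refl = begin
  suc (length xs)              ≤⟨ s≤s (unique-⊆-length xs (as ++ bs) u xs⊆) ⟩
  suc (length (as ++ bs))      ≡⟨ cong suc (length-++ as) ⟩
  suc (length as + length bs)  ≡⟨ sym (+-suc (length as) (length bs)) ⟩
  length as + length (x ∷ bs)  ≡⟨ sym (length-++ as) ⟩
  length (as ++ x ∷ bs)        ∎
  where
  open ≤-Reasoning
  xs⊆ : ∀ y → y ∈ xs → y ∈ as ++ bs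
  xs⊆ y m = ∈-mid⁻ as bs (h y (there m)) λ e → All.lookup a m (sym e)

unique-⊂-length : (xs ys : List X) {y : X} → Unique xs → (∀ x → x ∈ xs → x ∈ ys) → y ∈ ys → y ∉ xs →
                  length xs < length ys
unique-⊂-length xs ys {y} u h my ny =
  unique-⊆-length (y ∷ xs) ys (y∉ ∷ u) λ { x (here refl) → my ; x (there m) → h x m }
  where
  y∉ : All (λ z → ¬ y ≡ z) xs
  y∉ = All.tabulate λ { m refl → ny m }

unique-↭ : (xs ys : List X) → Unique xs → Unique ys →
           (∀ x → x ∈ xs → x ∈ ys) → (∀ x → x ∈ ys → x ∈ xs) → xs ↭ ys
unique-↭ xs ys u v f g = ∼bag⇒↭ (unique∧set⇒bag u v (mk⇔ (f _) (g _)))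

map-unique : (f : X → Y) (xs : List X) → Unique xs →
             (∀ x y → x ∈ xs → y ∈ xs → f x ≡ f y → x ≡ y) → Unique (map f xs)
map-unique f []       u h = []
map-unique f (x ∷ xs) (a ∷ u) h =
  All.tabulate (λ {z} m e → fresh m e)
  ∷ map-unique f xs u λ y z my mz e → h y z (there my) (there mz) e
  where
  fresh : ∀ {z} → z ∈ map f xs → f x ≡ z → ⊥
  fresh m refl with ∈-map⁻ f m
  ... | y , my , e = All.lookup a my (h x y (here refl) (there my) e)

==-true : ∀ {n} (u v : Fin n) → u == v ≡ true → u ≡ v
==-true u v e with u F.≟ v
... | yes p = p

==-refl : ∀ {n} (u : Fin n) → u == u ≡ true
==-refl u with u F.≟ u
... | yes _ = refl
... | no ne = ⊥-elim (ne refl)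

≡ᵇ-true : ∀ a b → (a ≡ᵇ b) ≡ true → a ≡ b
≡ᵇ-true a b e = ≡ᵇ⇒≡ a b (subst T (sym e) _)

≡ᵇ-refl : ∀ a → (a ≡ᵇ a) ≡ true
≡ᵇ-refl zero    = refl
≡ᵇ-refl (suc a) = ≡ᵇ-refl a

≡ᵇ-false : ∀ a b → ¬ a ≡ b → (a ≡ᵇ b) ≡ false
≡ᵇ-false a b ne = not-true _ λ e → ne (≡ᵇ-true a b e)

<?-true : ∀ a b → ⌊ a <? b ⌋ ≡ true → a < b
<?-true a b e with a <? b
... | yes p = p

<?-true⁺ : ∀ {a b} → a < b → ⌊ a <? b ⌋ ≡ true
<?-true⁺ {a} {b} l with a <? b
... | yes _ = refl
... | no nl = ⊥-elim (nl l)

<?-false : ∀ a b → ¬ a < b → ⌊ a <? b ⌋ ≡ false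
<?-false a b ne with a <? b
... | yes p = ⊥-elim (ne p)
... | no _  = refl

adj-∈ : ∀ {n} (A : List (Edge n)) u v → adjB A u v ≡ true → ∃[ e ] (e ∈ A × joins e u v ≡ true)
adj-∈ A u v = any-∈ (λ e → joins e u v) A

Reach : ∀ {n} → List (Edge n) → Fin n → Fin n → ℕ → Set
Reach A v u m = iter m (closeStep A) (λ w → w == v) u ≡ true

reach-refl : ∀ {n} (A : List (Edge n)) v → Reach A v v 0
reach-refl A v = ==-refl v

reach-step : ∀ {n} (A : List (Edge n)) {v w u m} → Reach A v w m → adjB A w u ≡ true → Reach A v u (suc m)
reach-step {n} A {v} {w} {u} {m} r a =
  trans (cong (iter m (closeStep A) (λ x → x == v) u ∨_)
          (∈-any (λ x → iter m (closeStep A) (λ y → y == v) x ∧ adjB A x u) (∈-allFin w) (cong₂ _∧_ r a)))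
        (∨-zeroʳ _)

reach-edge : ∀ {n} (A : List (Edge n)) {x y} → adjB A x y ≡ true → Reach A x y 1
reach-edge A {x} a = reach-step A {m = 0} (reach-refl A x) a

reach-mono : ∀ {n} (A : List (Edge n)) {v u m m'} → m ≤ m' → Reach A v u m → Reach A v u m'
reach-mono A {v} {u} {m} {m'} le r = subst (Reach A v u) (m∸n+n≡m le) (pad (m' ∸ m))
  where
  pad : ∀ d → Reach A v u (d + m)
  pad zero    = r
  pad (suc d) rewrite pad d = refl

iter-mono : ∀ {n} (A : List (Edge n)) b (S S' : Fin n → Bool) → (∀ u → S u ≡ true → S' u ≡ true) →
            ∀ u → iter b (closeStep A) S u ≡ true → iter b (closeStep A) S' u ≡ true
iter-mono A zero    S S' h = h
iter-mono {n} A (suc b) S S' h u e with ∨-true _ _ e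
... | inj₁ p rewrite iter-mono A b S S' h u p = refl
... | inj₂ p with any-∈ _ (allFin n) p
... | w , _ , q with ∧-true _ _ q
... | sw , a = trans (cong (iter b (closeStep A) S' u ∨_)
                       (∈-any (λ w → iter b (closeStep A) S' w ∧ adjB A w u) (∈-allFin w)
                              (cong₂ _∧_ (iter-mono A b S S' h w sw) a)))
                     (∨-zeroʳ (iter b (closeStep A) S' u))

iter-+ : (f : X → X) → ∀ b a x → iter (b + a) f x ≡ iter b f (iter a f x)
iter-+ f zero    a x = refl
iter-+ f (suc b) a x = cong f (iter-+ f b a x)

reach-trans : ∀ {n} (A : List (Edge n)) {x y z} a b → Reach A x y a → Reach A y z b → Reach A x z (b + a)
reach-trans A {x} {y} {z} a b r s =
  subst (λ S → S z ≡ true) (sym (iter-+ (closeStep A) b a (λ w → w == x)))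
    (iter-mono A b (λ w → w == y) (iter a (closeStep A) (λ w → w == x))
      (λ u e → subst (λ t → Reach A x t a) (sym (==-true u y e)) r) z s)

comp-label : ∀ {n} (A : List (Edge n)) (f : Fin n → X) → (∀ a b → adjB A a b ≡ true → f a ≡ f b) →
             ∀ v u → comp A v u ≡ true → f u ≡ f v
comp-label {n = n} A f edge v = go n
  where
  go : ∀ m u → iter m (closeStep A) (λ w → w == v) u ≡ true → f u ≡ f v
  go zero    u e = cong f (==-true u v e)
  go (suc m) u e with ∨-true _ _ e
  ... | inj₁ e' = go m u e'
  ... | inj₂ e' with any-∈ _ (allFin n) e'
  ... | w , _ , sw with ∧-true _ _ sw
  ... | s , a = trans (sym (edge w u a)) (go m w s)

module _ {n : ℕ} (A A' : List (Edge n)) (same : ∀ u v → adjB A u v ≡ adjB A' u v) where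

  iter-cong : ∀ m (S : Fin n → Bool) u → iter m (closeStep A) S u ≡ iter m (closeStep A') S u
  iter-cong zero    S u = refl
  iter-cong (suc m) S u =
    cong₂ _∨_ (iter-cong m S u) (any-cong _ _ (allFin n) λ w → cong₂ _∧_ (iter-cong m S w) (same w u))

  keep-cong : (p q : X → Bool) (xs : List X) → (∀ x → p x ≡ q x) → keep p xs ≡ keep q xs
  keep-cong p q []       h = refl
  keep-cong p q (x ∷ xs) h rewrite h x with q x
  ... | true  = cong (x ∷_) (keep-cong p q xs h)
  ... | false = keep-cong p q xs h

  partition-cong : partitionOf A ≡ partitionOf A'
  partition-cong =
    trans (cong (map _) (keep-cong _ _ (allFin n) λ v →
             cong not (any-cong _ _ (allFin n) λ u → cong (_∧ _) (iter-cong n _ u))))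
          (map-cong (λ v → count-cong _ _ (allFin n) λ u _ → iter-cong n _ u) _)

partition-↭ : ∀ {n} {A A' : List (Edge n)} → A ↭ A' → partitionOf A ≡ partitionOf A'
partition-↭ {A = A} {A'} r = partition-cong A A' λ u v → any-↭ (λ e → joins e u v) r

isRep-least : ∀ {n} (A : List (Edge n)) v → isRep A v ≡ true → ∀ u → comp A v u ≡ true → ¬ toℕ u < toℕ v
isRep-least {n} A v rep u c lt with any (λ u → comp A v u ∧ ⌊ toℕ u <? toℕ v ⌋) (allFin n) in eq
isRep-least A v () u c lt | true
... | false = t≢f (trans (sym (∈-any _ (∈-allFin u) (cong₂ _∧_ c (<?-true⁺ lt)))) eq)

least : ∀ {n} (q : Fin n → Bool) (b : ℕ) (u : Fin n) → toℕ u ≤ b → q u ≡ true →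
        ∃[ w ] (q w ≡ true × (∀ w' → q w' ≡ true → ¬ toℕ w' < toℕ w))
least {n} q b u le qu with any (λ w → q w ∧ ⌊ toℕ w <? toℕ u ⌋) (allFin n) in eq
... | false = u , qu , λ w' qw' lt → t≢f (trans (sym (∈-any _ (∈-allFin w') (cong₂ _∧_ qw' (<?-true⁺ lt)))) eq)
... | true with any-∈ (λ w → q w ∧ ⌊ toℕ w <? toℕ u ⌋) (allFin n) eq
... | w , _ , qw with ∧-true (q w) _ qw
... | qw' , w<u with b
... | zero   = ⊥-elim (n≮0 (≤-trans (<?-true _ _ w<u) le))
... | suc b' = least q b' w (≤-pred (≤-trans (<?-true _ _ w<u) le)) qw'

module ComponentLabelling {n : ℕ} (A : List (Edge n)) (f : Fin n → ℕ) (m : ℕ)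
  (same-comp : ∀ v u → comp A v u ≡ (f u ≡ᵇ f v))
  (bounded : ∀ u → f u < m)
  (onto : ∀ j → j < m → ∃[ u ] (f u ≡ j)) where

  classSize : ℕ → ℕ
  classSize j = count (λ u → f u ≡ᵇ j) (allFin n)

  private
    reps : List (Fin n)
    reps = keep (isRep A) (allFin n)

    reps-injective : ∀ v w → v ∈ reps → w ∈ reps → f v ≡ f w → v ≡ w
    reps-injective v w mv mw e = toℕ-injective (≤-antisym (≮⇒≥ (isRep-least A v rv w c₁))
                                                           (≮⇒≥ (isRep-least A w rw v c₂)))
      where
      rv = proj₂ (∈-keep⁻ (isRep A) (allFin n) mv)
      rw = proj₂ (∈-keep⁻ (isRep A) (allFin n) mw)
      c₁ = trans (same-comp v w) (trans (cong (f w ≡ᵇ_) e) (≡ᵇ-refl (f w)))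
      c₂ = trans (same-comp w v) (trans (cong (f v ≡ᵇ_) (sym e)) (≡ᵇ-refl (f v)))

    labels⊆ : ∀ j → j ∈ map f reps → j ∈ upTo m
    labels⊆ j mj with ∈-map⁻ f mj
    ... | v , _ , refl = ∈-upTo⁺ (bounded v)

    -- the least vertex with label j represents its component
    labels⊇ : ∀ j → j ∈ upTo m → j ∈ map f reps
    labels⊇ j mj with onto j (∈-upTo⁻ mj)
    ... | u , fu with least (λ w → f w ≡ᵇ j) (toℕ u) u ≤-refl (trans (cong (_≡ᵇ j) fu) (≡ᵇ-refl j))
    ... | w , qw , minimal = subst (_∈ map f reps) (≡ᵇ-true _ _ qw) (∈-map⁺ f (∈-keep⁺ (isRep A) (∈-allFin w) rep))
      where
      rep : isRep A w ≡ true
      rep = cong not (any-false _ (allFin n) λ x _ → not-true _ λ t →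
              let inComp , smaller = ∧-true _ _ t in
              minimal x (trans (sym (cong (f x ≡ᵇ_) (≡ᵇ-true _ _ qw))) (trans (sym (same-comp w x)) inComp))
                        (<?-true _ _ smaller))

  partition-labels : partitionOf A ↭ map classSize (upTo m)
  partition-labels =
    ↭-trans (↭-reflexive (trans (map-cong (λ v → count-cong _ _ (allFin n) λ u _ → same-comp v u) reps)
                                (map-∘ reps)))
            (map⁺ classSize (unique-↭ (map f reps) (upTo m)
               (map-unique f reps (keep-unique (isRep A) (allFin n) (allFin⁺ n)) reps-injective)
               (upTo⁺ m) labels⊆ labels⊇))

subsets-cons : (Q : List X → Y) (x : X) (xs : List X) →
               map Q (subsets (x ∷ xs)) ≡ map (λ s → Q (x ∷ s)) (subsets xs) ++ map Q (subsets xs)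
subsets-cons Q x xs = trans (map-++ Q (map (x ∷_) (subsets xs)) (subsets xs))
                            (cong (_++ map Q (subsets xs)) (sym (map-∘ (subsets xs))))

interchange-↭ : {a b c d a' b' c' d' : List Y} → a ↭ a' → b ↭ b' → c ↭ c' → d ↭ d' →
                (a ++ b) ++ (c ++ d) ↭ (a' ++ c') ++ (b' ++ d')
interchange-↭ {a = a} {b} {c} {d} p q r s =
  ↭-trans (↭-reflexive (++-assoc a b (c ++ d)))
   (↭-trans (++⁺ˡ a (↭-trans (↭-reflexive (sym (++-assoc b c d)))
                     (↭-trans (++⁺ʳ d (++-comm b c)) (↭-reflexive (++-assoc c b d)))))
    (↭-trans (↭-reflexive (sym (++-assoc a c (b ++ d)))) (++⁺ (++⁺ p r) (++⁺ q s))))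

subsets-↭ : (Q : List X → Y) → (∀ {a b} → a ↭ b → Q a ≡ Q b) →
            ∀ {xs ys} → xs ↭ ys → map Q (subsets xs) ↭ map Q (subsets ys)
subsets-↭ Q inv Perm.refl = ↭-refl
subsets-↭ Q inv {x ∷ xs} {.x ∷ ys} (Perm.prep x r) =
  ↭-trans (↭-reflexive (subsets-cons Q x xs))
   (↭-trans (++⁺ (subsets-↭ (λ s → Q (x ∷ s)) (λ r' → inv (prep x r')) r) (subsets-↭ Q inv r))
            (↭-reflexive (sym (subsets-cons Q x ys))))
subsets-↭ Q inv {x ∷ y ∷ xs} {.y ∷ .x ∷ ys} (Perm.swap x y r) =
  ↭-trans (↭-reflexive (expand x y xs))
   (↭-trans (interchange-↭ xy (subsets-↭ (λ s → Q (x ∷ s)) (λ r' → inv (prep x r')) r)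
                              (subsets-↭ (λ s → Q (y ∷ s)) (λ r' → inv (prep y r')) r)
                              (subsets-↭ Q inv r))
            (↭-reflexive (sym (expand y x ys))))
  where
  expand : ∀ x y zs → map Q (subsets (x ∷ y ∷ zs)) ≡
           (map (λ s → Q (x ∷ y ∷ s)) (subsets zs) ++ map (λ s → Q (x ∷ s)) (subsets zs))
           ++ (map (λ s → Q (y ∷ s)) (subsets zs) ++ map Q (subsets zs))
  expand x y zs = trans (subsets-cons Q x (y ∷ zs))
                        (cong₂ _++_ (subsets-cons (λ s → Q (x ∷ s)) y zs) (subsets-cons Q y zs))
  xy : map (λ s → Q (x ∷ y ∷ s)) (subsets xs) ↭ map (λ s → Q (y ∷ x ∷ s)) (subsets ys)
  xy = ↭-trans (subsets-↭ (λ s → Q (x ∷ y ∷ s)) (λ r' → inv (prep x (prep y r'))) r)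
               (↭-reflexive (map-cong (λ s → inv (swap x y ↭-refl)) (subsets ys)))
subsets-↭ Q inv (Perm.trans r s) = ↭-trans (subsets-↭ Q inv r) (subsets-↭ Q inv s)

subsets-++ : (xs ys : List X) → subsets (xs ++ ys) ≡ concatMap (λ s → map (s ++_) (subsets ys)) (subsets xs)
subsets-++ [] ys = sym (trans (++-identityʳ _) (map-id _))
subsets-++ (x ∷ xs) ys rewrite subsets-++ xs ys =
  sym (trans (concatMap-++ F (map (x ∷_) (subsets xs)) (subsets xs)) (cong (_++ _) (extend (subsets xs))))
  where
  F : List _ → List (List _)
  F s = map (s ++_) (subsets ys)
  extend : ∀ ss → concatMap F (map (x ∷_) ss) ≡ map (x ∷_) (concatMap F ss)
  extend []       = refl
  extend (s ∷ ss) = trans (cong (_++ concatMap F (map (x ∷_) ss)) (map-∘ (subsets ys)))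
                          (trans (cong (map (x ∷_) (F s) ++_) (extend ss)) (sym (map-++ (x ∷_) (F s) _)))

choices : ℕ → List (List Bool)
choices zero    = [] ∷ []
choices (suc m) = map (true ∷_) (choices m) ++ map (false ∷_) (choices m)

choices-length : ∀ m {c} → c ∈ choices m → length c ≡ m
choices-length zero    (here refl) = refl
choices-length (suc m) mc with ∈-++⁻ (map (true ∷_) (choices m)) mc
... | inj₁ mt with ∈-map⁻ (true ∷_) mt
...   | c' , mc' , refl = cong suc (choices-length m mc')
choices-length (suc m) mc | inj₂ mf with ∈-map⁻ (false ∷_) mf
...   | c' , mc' , refl = cong suc (choices-length m mc')

select : List X → List Bool → List X
select []       c           = []
select (x ∷ xs) []          = []
select (x ∷ xs) (true ∷ c)  = x ∷ select xs c
select (x ∷ xs) (false ∷ c) = select xs c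

select-⊆ : (xs : List X) (c : List Bool) {e : X} → e ∈ select xs c → e ∈ xs
select-⊆ (x ∷ xs) (true ∷ c)  (here refl) = here refl
select-⊆ (x ∷ xs) (true ∷ c)  (there m)   = there (select-⊆ xs c m)
select-⊆ (x ∷ xs) (false ∷ c) m           = there (select-⊆ xs c m)

subsets-select : (xs : List X) → subsets xs ≡ map (select xs) (choices (length xs))
subsets-select [] = refl
subsets-select (x ∷ xs) rewrite subsets-select xs =
  sym (trans (map-++ (select (x ∷ xs)) (map (true ∷_) C) _)
       (cong₂ _++_ (trans (sym (map-∘ C)) (map-∘ C)) (sym (map-∘ C))))
  where C = choices (length xs)

properSubsets : List X → List (List X)
properSubsets []       = []
properSubsets (x ∷ xs) = map (x ∷_) (properSubsets xs) ++ subsets xs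

subsets-whole : (xs : List X) → subsets xs ≡ xs ∷ properSubsets xs
subsets-whole []       = refl
subsets-whole (x ∷ xs) rewrite subsets-whole xs = refl

subsets-⊆ : (xs : List X) {l : List X} → l ∈ subsets xs → ∀ {y} → y ∈ l → y ∈ xs
subsets-⊆ []       (here refl) ()
subsets-⊆ (x ∷ xs) m ym with ∈-++⁻ (map (x ∷_) (subsets xs)) m
... | inj₂ m₂ = there (subsets-⊆ xs m₂ ym)
... | inj₁ m₁ with ∈-map⁻ (x ∷_) m₁
... | l' , ml' , refl with ym
... | here refl = here refl
... | there ym' = there (subsets-⊆ xs ml' ym')

properSubsets-miss : (xs : List X) → Unique xs → {l : List X} → l ∈ properSubsets xs → ∃[ y ] (y ∈ xs × y ∉ l)
properSubsets-miss (x ∷ xs) (a ∷ u) m with ∈-++⁻ (map (x ∷_) (properSubsets xs)) m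
... | inj₂ m₂ = x , here refl , λ xl → All.lookup a (subsets-⊆ xs m₂ xl) refl
... | inj₁ m₁ with ∈-map⁻ (x ∷_) m₁
... | l' , ml' , refl with properSubsets-miss xs u ml'
... | y , my , ny = y , there my , λ { (here refl) → All.lookup a my refl ; (there q) → ny q }

-- Coarsenings by choice vectors.  A coarsening of b₁ ⋯ b_k is determined
-- by choosing, for each of the k − 1 gaps, whether to merge across it.

mergeFirst : ℕ → List ℕ → List ℕ
mergeFirst b []       = b ∷ []
mergeFirst b (a ∷ as) = (b + a) ∷ as

coarsen : List ℕ → List Bool → List ℕ
coarsen []           c           = []
coarsen (b ∷ [])     c           = b ∷ []
coarsen (b ∷ b' ∷ bs) []          = b ∷ b' ∷ bs
coarsen (b ∷ b' ∷ bs) (true ∷ c)  = mergeFirst b (coarsen (b' ∷ bs) c)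
coarsen (b ∷ b' ∷ bs) (false ∷ c) = b ∷ coarsen (b' ∷ bs) c

NonEmpty : List ℕ → Set
NonEmpty []      = ⊥
NonEmpty (_ ∷ _) = ⊤

module _ (b : ℕ) (ext : List ℕ → List (List ℕ))
         (ext-def : ∀ a as → ext (a ∷ as) ≡ (b ∷ a ∷ as) ∷ ((b + a) ∷ as) ∷ []) where

  concatMap-ext : ∀ αs → All NonEmpty αs → concatMap ext αs ↭ map (mergeFirst b) αs ++ map (b ∷_) αs
  concatMap-ext []                _        = ↭-refl
  concatMap-ext ((a ∷ as) ∷ αs) (_ ∷ ne) rewrite ext-def a as =
    ↭-trans (swap (b ∷ a ∷ as) ((b + a) ∷ as) ↭-refl)
     (prep ((b + a) ∷ as)
       (↭-trans (prep (b ∷ a ∷ as) (concatMap-ext αs ne))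
         (↭-sym (shift (b ∷ a ∷ as) (map (mergeFirst b) αs) (map (b ∷_) αs)))))

  concatMap-ext-nonEmpty : ∀ αs → All NonEmpty αs → All NonEmpty (concatMap ext αs)
  concatMap-ext-nonEmpty []                _        = []
  concatMap-ext-nonEmpty ((a ∷ as) ∷ αs) (_ ∷ ne) rewrite ext-def a as = _ ∷ _ ∷ concatMap-ext-nonEmpty αs ne

coarsenings-choices′ : ∀ b bs → (coarsenings (b ∷ bs) ↭ map (coarsen (b ∷ bs)) (choices (length bs)))
                               × All NonEmpty (coarsenings (b ∷ bs))
coarsenings-choices′ b []         = ↭-refl , _ ∷ []
coarsenings-choices′ b (b' ∷ bs) =
  let r , ne = coarsenings-choices′ b' bs
      C      = choices (length bs)
  in ↭-trans (concatMap-ext b _ (λ a as → refl) (coarsenings (b' ∷ bs)) ne)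
      (↭-trans (++⁺ (map⁺ (mergeFirst b) r) (map⁺ (b ∷_) r))
        (↭-reflexive (sym (trans (map-++ (coarsen (b ∷ b' ∷ bs)) (map (true ∷_) C) _)
                 (cong₂ _++_ (trans (sym (map-∘ C)) (map-∘ C)) (trans (sym (map-∘ C)) (map-∘ C)))))))
     , concatMap-ext-nonEmpty b _ (λ a as → refl) (coarsenings (b' ∷ bs)) ne

coarsenings-choices : ∀ β → 1 ≤ length β → coarsenings β ↭ map (coarsen β) (choices (length β ∸ 1))
coarsenings-choices (b ∷ bs) _ = proj₁ (coarsenings-choices′ b bs)

coarsen-≥ : ∀ {ℓ} β c → All (ℓ ≤_) β → All (ℓ ≤_) (coarsen β c)
coarsen-≥ []            c           h          = []
coarsen-≥ (b ∷ [])      c           h          = h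
coarsen-≥ (b ∷ b' ∷ bs) []          h          = h
coarsen-≥ (b ∷ b' ∷ bs) (true ∷ c)  (lb ∷ h)   = merged-bound (coarsen (b' ∷ bs) c) (coarsen-≥ (b' ∷ bs) c h)
  where
  merged-bound : ∀ as → All (_ ≤_) as → All (_ ≤_) (mergeFirst b as)
  merged-bound []       _        = lb ∷ []
  merged-bound (a ∷ as) (_ ∷ h') = ≤-trans lb (m≤m+n b a) ∷ h'
coarsen-≥ (b ∷ b' ∷ bs) (false ∷ c) (lb ∷ h)   = lb ∷ coarsen-≥ (b' ∷ bs) c h

NoUnitPart : Monomial → Set
NoUnitPart m = 1 ∉ m

noUnitPart? : (m : Monomial) → Dec (NoUnitPart m)
noUnitPart? m = ¬? (1 ∈ℕ? m)

withoutUnit : Poly → Poly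
withoutUnit = filter noUnitPart?

withoutUnit-≈ : {P Q : Poly} → P ≈P Q → withoutUnit P ≈P withoutUnit Q
withoutUnit-≈ = PermSP.filter⁺ ↭-setoid noUnitPart? λ r 1∉ 1∈ → 1∉ (∈-resp-↭ (↭-sym r) 1∈)

↭⇒≈P : {P Q : Poly} → P ↭ Q → P ≈P Q
↭⇒≈P = ↭⇒↭ₛ′ ↭-isEquivalence

sumTo : ℕ → (ℕ → ℕ) → ℕ
sumTo zero    F = 0
sumTo (suc k) F = F 0 + sumTo k (λ i → F (suc i))

sumTo-cong : ∀ k (F G : ℕ → ℕ) → (∀ i → i < k → F i ≡ G i) → sumTo k F ≡ sumTo k G
sumTo-cong zero    F G h = refl
sumTo-cong (suc k) F G h = cong₂ _+_ (h 0 (s≤s z≤n)) (sumTo-cong k _ _ λ i lt → h (suc i) (s≤s lt))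

sumTo-zero : ∀ k (F : ℕ → ℕ) → (∀ i → F i ≡ 0) → sumTo k F ≡ 0
sumTo-zero zero    F h = refl
sumTo-zero (suc k) F h rewrite h 0 = sumTo-zero k _ λ i → h (suc i)

sumTo-+ : ∀ k (F G : ℕ → ℕ) → sumTo k (λ i → F i + G i) ≡ sumTo k F + sumTo k G
sumTo-+ zero    F G = refl
sumTo-+ (suc k) F G =
  trans (cong ((F 0 + G 0) +_) (sumTo-+ k (λ i → F (suc i)) (λ i → G (suc i))))
        (interchange (F 0) (G 0) (sumTo k (λ i → F (suc i))) (sumTo k (λ i → G (suc i))))

indicator : Bool → ℕ
indicator b = if b then 1 else 0

indicator-∧-false : ∀ b → indicator (b ∧ false) ≡ 0
indicator-∧-false true  = refl
indicator-∧-false false = refl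

sumTo-point : ∀ k (h : ℕ → Bool) p → p < k → sumTo k (λ i → indicator (h i ∧ (p ≡ᵇ i))) ≡ indicator (h p)
sumTo-point (suc k) h zero lt with h 0
... | true  = cong suc (sumTo-zero k _ λ i → indicator-∧-false (h (suc i)))
... | false = sumTo-zero k _ λ i → indicator-∧-false (h (suc i))
sumTo-point (suc k) h (suc p) (s≤s lt) =
  trans (cong (_+ sumTo k (λ i → indicator (h (suc i) ∧ (p ≡ᵇ i)))) (indicator-∧-false (h 0)))
        (sumTo-point k (λ i → h (suc i)) p lt)

count-fibres : (par : X → ℕ) (k : ℕ) (h : ℕ → Bool) (xs : List X) → (∀ x → x ∈ xs → par x < k) →
  count (λ x → h (par x)) xs ≡ sumTo k (λ i → if h i then count (λ u → par u ≡ᵇ i) xs else 0)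
count-fibres par k h [] bd = sym (sumTo-zero k _ λ i → zero-if (h i))
  where zero-if : ∀ b → (if b then 0 else 0) ≡ 0
        zero-if true  = refl
        zero-if false = refl
count-fibres par k h (x ∷ xs) bd =
  trans head (sym (trans (sumTo-cong k _ _ λ i _ → split i) (sumTo-+ k _ _)))
  where
  IH = count-fibres par k h xs (λ y m → bd y (there m))
  C : ℕ → ℕ
  C i = count (λ u → par u ≡ᵇ i) xs
  split : ∀ i → (if h i then count (λ u → par u ≡ᵇ i) (x ∷ xs) else 0) ≡
                (if h i then C i else 0) + indicator (h i ∧ (par x ≡ᵇ i))
  split i with h i | par x ≡ᵇ i
  ... | true  | true  = +-comm 1 _
  ... | true  | false = sym (+-identityʳ _)
  ... | false | _     = refl
  head : count (λ y → h (par y)) (x ∷ xs) ≡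
         sumTo k (λ i → if h i then C i else 0) + sumTo k (λ i → indicator (h i ∧ (par x ≡ᵇ i)))
  head rewrite sumTo-point k h (par x) (bd x (here refl)) with h (par x)
  ... | true  = trans (cong suc IH) (+-comm 1 _)
  ... | false = trans IH (sym (+-identityʳ _))

-- For positions 0, …, length c of a spine and
-- a choice vector c for its gaps, block c i is the index of the maximal
-- run of merged positions containing i; there are cuts c + 1 blocks.

merged : List Bool → ℕ → Bool
merged []      i       = false
merged (m ∷ c) zero    = m
merged (m ∷ c) (suc i) = merged c i

block : List Bool → ℕ → ℕ
block c       zero    = 0
block []      (suc i) = 0
block (m ∷ c) (suc i) = (if m then 0 else 1) + block c i

cuts : List Bool → ℕ
cuts []          = 0
cuts (true ∷ c)  = cuts c
cuts (false ∷ c) = suc (cuts c)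

block-step : ∀ c i → suc i ≤ length c → block c (suc i) ≡ (if merged c i then 0 else 1) + block c i
block-step (true ∷ c)  zero    _        = refl
block-step (false ∷ c) zero    _        = refl
block-step (m ∷ c)     (suc i) (s≤s le) rewrite block-step c i le with m | merged c i
... | true  | true  = refl
... | true  | false = refl
... | false | true  = refl
... | false | false = refl

block-≤-cuts : ∀ c i → block c i ≤ cuts c
block-≤-cuts c           zero    = z≤n
block-≤-cuts []          (suc i) = z≤n
block-≤-cuts (true ∷ c)  (suc i) = block-≤-cuts c i
block-≤-cuts (false ∷ c) (suc i) = s≤s (block-≤-cuts c i)

block-mono : ∀ c i j → i ≤ j → j ≤ length c → block c i ≤ block c j
block-mono c i zero    z≤n    _  = ≤-refl
block-mono c i (suc j) i≤1+j lj with m≤n⇒m<n∨m≡n i≤1+j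
... | inj₂ refl = ≤-refl
... | inj₁ (s≤s i≤j) rewrite block-step c j lj =
  ≤-trans (block-mono c i j i≤j (≤-trans (n≤1+n j) lj)) (m≤n+m _ _)

block-merged : ∀ c i → suc i ≤ length c → merged c i ≡ true → block c (suc i) ≡ block c i
block-merged c i le e rewrite block-step c i le | e = refl

block-eq⇒merged : ∀ c i j l → i ≤ l → l < j → j ≤ length c → block c i ≡ block c j → merged c l ≡ true
block-eq⇒merged c i j l il lj jc e with merged c l in eq
... | true  = refl
... | false = ⊥-elim (<⇒≢ jump e)
  where
  jump : block c i < block c j
  jump = begin-strict
    block c i                                ≤⟨ block-mono c i l il (≤-trans (<⇒≤ lj) jc) ⟩
    block c l                                <⟨ n<1+n _ ⟩
    suc (block c l)                          ≡⟨ cong (λ b → (if b then 0 else 1) + block c l) (sym eq) ⟩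
    (if merged c l then 0 else 1) + block c l ≡⟨ sym (block-step c l (≤-trans lj jc)) ⟩
    block c (suc l)                          ≤⟨ block-mono c (suc l) j lj jc ⟩
    block c j                                ∎
    where open ≤-Reasoning

block-onto : ∀ c j → j < suc (cuts c) → ∃[ i ] (i < suc (length c) × block c i ≡ j)
block-onto []          zero    _        = 0 , s≤s z≤n , refl
block-onto []          (suc j) (s≤s ())
block-onto (true ∷ c)  j       lt with block-onto c j lt
... | i , l , e = suc i , s≤s l , e
block-onto (false ∷ c) zero    _        = 0 , s≤s z≤n , refl
block-onto (false ∷ c) (suc j) (s≤s lt) with block-onto c j lt
... | i , l , e = suc i , s≤s l , cong suc e

block-sums : ∀ (c : List Bool) (w : ℕ → ℕ) →
  applyUpTo (λ j → sumTo (suc (length c)) (λ i → if block c i ≡ᵇ j then w i else 0)) (suc (cuts c))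
  ≡ coarsen (applyUpTo w (suc (length c))) c
block-sums []          w = cong (_∷ []) (+-identityʳ (w 0))
block-sums (true ∷ c)  w = cong (mergeFirst (w 0)) (block-sums c (λ i → w (suc i)))
block-sums (false ∷ c) w =
  cong₂ _∷_ (trans (cong (w 0 +_) (sumTo-zero (suc (length c)) _ λ i → refl)) (+-identityʳ (w 0)))
            (block-sums c (λ i → w (suc i)))

joins-sym : ∀ {n} (e : Edge n) u v → joins e u v ≡ joins e v u
joins-sym (a , b) u v = ∨-comm (a == u ∧ b == v) (a == v ∧ b == u)

adj-sym : ∀ {n} (A : List (Edge n)) u v → adjB A u v ≡ adjB A v u
adj-sym A u v = any-cong _ _ A λ e → joins-sym e u v

joins-ends : ∀ {n} (e : Edge n) u v → joins e u v ≡ true →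
             (proj₁ e ≡ u × proj₂ e ≡ v) ⊎ (proj₁ e ≡ v × proj₂ e ≡ u)
joins-ends (a , b) u v j with ∨-true _ _ j
... | inj₁ x = let p , q = ∧-true _ _ x in inj₁ (==-true a u p , ==-true b v q)
... | inj₂ x = let p , q = ∧-true _ _ x in inj₂ (==-true a v p , ==-true b u q)

joins-self : ∀ {n} (e : Edge n) → joins e (proj₁ e) (proj₂ e) ≡ true
joins-self (a , b) rewrite ==-refl a | ==-refl b = refl

joins-same : ∀ {n} (e : Edge n) {u v u' v'} → joins e u v ≡ true → joins e u' v' ≡ true →
             (u ≡ u' × v ≡ v') ⊎ (u ≡ v' × v ≡ u')
joins-same e {u} {v} {u'} {v'} j j' with joins-ends e u v j | joins-ends e u' v' j'
... | inj₁ (p , q) | inj₁ (p' , q') = inj₁ (trans (sym p) p' , trans (sym q) q')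
... | inj₁ (p , q) | inj₂ (p' , q') = inj₂ (trans (sym p) p' , trans (sym q) q')
... | inj₂ (p , q) | inj₁ (p' , q') = inj₂ (trans (sym q) q' , trans (sym p) p')
... | inj₂ (p , q) | inj₂ (p' , q') = inj₁ (trans (sym q) q' , trans (sym p) p')

isolated-part : ∀ {n} (A : List (Edge n)) u → (∀ w → adjB A u w ≡ false) → 1 ∈ partitionOf A
isolated-part {n} A u isolated =
  subst (_∈ partitionOf A) size-one (∈-map⁺ (λ v → count (comp A v) (allFin n)) (∈-keep⁺ (isRep A) (∈-allFin u) rep))
  where
  outside : Fin n → ℕ
  outside w = if w == u then 0 else 1
  outside-edge : ∀ a b → adjB A a b ≡ true → outside a ≡ outside b
  outside-edge a b ab with a F.≟ u | b F.≟ u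
  ... | yes refl | _      = ⊥-elim (t≢f (trans (sym ab) (isolated b)))
  ... | no _     | yes refl = ⊥-elim (t≢f (trans (sym ab) (trans (adj-sym A a u) (isolated a))))
  ... | no _     | no _   = refl
  only-u : ∀ w → comp A u w ≡ true → w ≡ u
  only-u w c with comp-label A outside outside-edge u w c
  ... | e with w F.≟ u
  ... | yes p = p
  ... | no _ rewrite ==-refl u = ⊥-elim (1≢0 e)
    where 1≢0 : 1 ≡ 0 → ⊥
          1≢0 ()
  size-one : count (comp A u) (allFin n) ≡ 1
  size-one = count-single (comp A u) (allFin⁺ n) (∈-allFin u) (reach-mono A {u} {u} {0} {n} z≤n (reach-refl A u))
                          λ y _ q → only-u y q
  rep : isRep A u ≡ true
  rep = cong not (any-false _ (allFin n) λ w _ → not-smaller w)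
    where
    not-smaller : ∀ w → comp A u w ∧ ⌊ toℕ w <? toℕ u ⌋ ≡ false
    not-smaller w with comp A u w in e
    ... | false = refl
    ... | true rewrite only-u w e = <?-false (toℕ u) (toℕ u) (n≮n (toℕ u))

nthD : X → List X → ℕ → X
nthD d []       i       = d
nthD d (x ∷ xs) zero    = x
nthD d (x ∷ xs) (suc i) = nthD d xs i

nthD-∈ : (d : X) (xs : List X) → ∀ i → i < length xs → nthD d xs i ∈ xs
nthD-∈ d (x ∷ xs) zero    lt       = here refl
nthD-∈ d (x ∷ xs) (suc i) (s≤s lt) = there (nthD-∈ d xs i lt)

nthD-map : (f : X → Y) (d : X) (d' : Y) (xs : List X) → ∀ i → i < length xs → nthD d' (map f xs) i ≡ f (nthD d xs i)
nthD-map f d d' (x ∷ xs) zero    lt       = refl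
nthD-map f d d' (x ∷ xs) (suc i) (s≤s lt) = nthD-map f d d' xs i lt

applyUpTo-nthD : (xs : List ℕ) → xs ≡ applyUpTo (nthD 0 xs) (length xs)
applyUpTo-nthD []       = refl
applyUpTo-nthD (x ∷ xs) = cong (x ∷_) (applyUpTo-nthD xs)

applyUpTo-cong : ∀ r {F G : ℕ → ℕ} → (∀ j → F j ≡ G j) → applyUpTo F r ≡ applyUpTo G r
applyUpTo-cong zero    h = refl
applyUpTo-cong (suc r) h = cong₂ _∷_ (h 0) (applyUpTo-cong r λ j → h (suc j))

position : ∀ {n} → List (Fin n) → Fin n → ℕ
position []       u = 0
position (v ∷ vs) u = if v == u then 0 else suc (position vs u)

nthD-position : ∀ {n} (d : Fin n) (vs : List (Fin n)) {u} → u ∈ vs →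
                nthD d vs (position vs u) ≡ u × position vs u < length vs
nthD-position d (v ∷ vs) {u} m with v F.≟ u
... | yes refl = refl , s≤s z≤n
nthD-position d (v ∷ vs) {u} (here refl) | no ne = ⊥-elim (ne refl)
nthD-position d (v ∷ vs) {u} (there m)   | no ne = let a , b = nthD-position d vs m in a , s≤s b

position-nthD : ∀ {n} (d : Fin n) (vs : List (Fin n)) → Unique vs → ∀ i → i < length vs →
                position vs (nthD d vs i) ≡ i
position-nthD d (v ∷ vs) u       zero    lt rewrite ==-refl v = refl
position-nthD d (v ∷ vs) (a ∷ u) (suc i) (s≤s lt) with v F.≟ nthD d vs i
... | yes e = ⊥-elim (All.lookup a (nthD-∈ d vs i lt) e)
... | no _  = cong suc (position-nthD d vs u i lt)

head-of : (xs : List X) → 2 ≤ length xs → X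
head-of (x ∷ xs) _ = x

head-of-∈ : (xs : List X) (p : 2 ≤ length xs) → head-of xs p ∈ xs
head-of-∈ (x ∷ xs) _ = here refl

first : (X → Bool) → List X → X → X
first p []       z = z
first p (x ∷ xs) z = if p x then x else first p xs z

first-spec : (p : X → Bool) (xs : List X) (z : X) → any p xs ≡ true → first p xs z ∈ xs × p (first p xs z) ≡ true
first-spec p (x ∷ xs) z e with p x in px
... | true  = here refl , px
... | false = let a , b = first-spec p xs z e in there a , b

Simple : ∀ {n} → List (Edge n) → Set
Simple = AllPairs (λ e f → joins e (proj₁ f) (proj₂ f) ≡ false)

simple-unique : ∀ {n} {A : List (Edge n)} → Simple A → Unique A
simple-unique = AllPairs.map λ {e} {f} j e≡f → t≢f (trans (sym (subst (λ g → joins e (proj₁ g) (proj₂ g) ≡ true) e≡f (joins-self e))) j)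

joins-transfer : ∀ {n} (e f : Edge n) {u v} → joins e u v ≡ true → joins f u v ≡ true →
                 joins e (proj₁ f) (proj₂ f) ≡ true
joins-transfer e f {u} {v} je jf with joins-ends f u v jf
... | inj₁ (p , q) rewrite p | q = je
... | inj₂ (p , q) rewrite p | q = trans (joins-sym e v u) je

simple-same-ends : ∀ {n} {A : List (Edge n)} {e f : Edge n} {u v} → Simple A → e ∈ A → f ∈ A →
                   joins e u v ≡ true → joins f u v ≡ true → e ≡ f
simple-same-ends {e = e} {f} (a ∷ s) (here refl) (here refl) je jf = refl
simple-same-ends {e = e} {f} (a ∷ s) (here refl) (there mf) je jf =
  ⊥-elim (t≢f (trans (sym (joins-transfer e f je jf)) (All.lookup a mf)))
simple-same-ends {e = e} {f} (a ∷ s) (there me) (here refl) je jf =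
  ⊥-elim (t≢f (trans (sym (joins-transfer f e jf je)) (All.lookup a me)))
simple-same-ends (a ∷ s) (there me) (there mf) je jf = simple-same-ends s me mf je jf

pathEdges : ∀ {n} {A : List (Edge n)} {ws} → IsPath A ws → List (Edge n)
pathEdges nil                    = []
pathEdges (one v)                = []
pathEdges {A = A} (cons {u} {v} a p) = proj₁ (adj-∈ A u v a) ∷ pathEdges p

pathEdges-length : ∀ {n} {A : List (Edge n)} {ws} (p : IsPath A ws) → length (pathEdges p) ≡ length ws ∸ 1
pathEdges-length nil        = refl
pathEdges-length (one v)    = refl
pathEdges-length (cons a p) = cong suc (pathEdges-length p)

pathEdges-⊆ : ∀ {n} {A : List (Edge n)} {ws} (p : IsPath A ws) {e} → e ∈ pathEdges p → e ∈ A
pathEdges-⊆ {A = A} (cons {u} {v} a p) (here refl) = proj₁ (proj₂ (adj-∈ A u v a))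
pathEdges-⊆ (cons a p) (there m) = pathEdges-⊆ p m

pathEdges-ends : ∀ {n} {A : List (Edge n)} {ws} (p : IsPath A ws) {e} → e ∈ pathEdges p →
                 proj₁ e ∈ ws × proj₂ e ∈ ws
pathEdges-ends {A = A} (cons {u} {v} a p) (here refl) with joins-ends _ u v (proj₂ (proj₂ (adj-∈ A u v a)))
... | inj₁ (x , y) = subst (_∈ _) (sym x) (here refl) , subst (_∈ _) (sym y) (there (here refl))
... | inj₂ (x , y) = subst (_∈ _) (sym x) (there (here refl)) , subst (_∈ _) (sym y) (here refl)
pathEdges-ends (cons a p) (there m) = let x , y = pathEdges-ends p m in there x , there y

pathEdges-unique : ∀ {n} {A : List (Edge n)} {ws} (p : IsPath A ws) → Unique ws → Unique (pathEdges p)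
pathEdges-unique nil     u = []
pathEdges-unique (one v) u = []
pathEdges-unique {A = A} (cons {u₀} {v} a p) (u₀∉ ∷ u) = All.tabulate (λ m eq → fresh m eq) ∷ pathEdges-unique p u
  where
  e₀ = proj₁ (adj-∈ A u₀ v a)
  fresh : ∀ {e} → e ∈ pathEdges p → e₀ ≡ e → ⊥
  fresh m refl with joins-ends e₀ u₀ v (proj₂ (proj₂ (adj-∈ A u₀ v a))) | pathEdges-ends p m
  ... | inj₁ (x , _) | y , _ = All.lookup u₀∉ (subst (_∈ _) x y) refl
  ... | inj₂ (_ , x) | _ , y = All.lookup u₀∉ (subst (_∈ _) x y) refl

pathEdges-select : ∀ {n} {A : List (Edge n)} (d : Fin n) {ws} (p : IsPath A ws) (c : List Bool) {e} →
  e ∈ select (pathEdges p) c →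
  ∃[ i ] (suc i < length ws × merged c i ≡ true × joins e (nthD d ws i) (nthD d ws (suc i)) ≡ true)
pathEdges-select {A = A} d (cons {u} {v} a (one _)) (true ∷ c) (here refl) =
  0 , s≤s (s≤s z≤n) , refl , proj₂ (proj₂ (adj-∈ A u v a))
pathEdges-select {A = A} d (cons {u} {v} a (cons b p)) (true ∷ c) (here refl) =
  0 , s≤s (s≤s z≤n) , refl , proj₂ (proj₂ (adj-∈ A u v a))
pathEdges-select d (cons a p) (true ∷ c) (there m) with pathEdges-select d p c m
... | i , lt , l , j = suc i , s≤s lt , l , j
pathEdges-select d (cons a p) (false ∷ c) m with pathEdges-select d p c m
... | i , lt , l , j = suc i , s≤s lt , l , j

select-pathEdges-adj : ∀ {n} {A : List (Edge n)} (d : Fin n) {ws} (p : IsPath A ws) (c : List Bool) i →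
  suc i < length ws → merged c i ≡ true → adjB (select (pathEdges p) c) (nthD d ws i) (nthD d ws (suc i)) ≡ true
select-pathEdges-adj {A = A} d (cons {u} {v} a p) (true ∷ c) zero lt l =
  ∈-any (λ e → joins e u v) {xs = proj₁ (adj-∈ A u v a) ∷ select (pathEdges p) c} (here refl)
        (proj₂ (proj₂ (adj-∈ A u v a)))
select-pathEdges-adj {A = A} d (cons {u} {v} a p) (true ∷ c) (suc i) (s≤s lt) l =
  trans (cong (joins (proj₁ (adj-∈ A u v a)) _ _ ∨_) (select-pathEdges-adj d p c i lt l)) (∨-zeroʳ _)
select-pathEdges-adj d (cons a p) (false ∷ c) (suc i) (s≤s lt) l = select-pathEdges-adj d p c i lt l
select-pathEdges-adj d (one v) c i (s≤s ()) l
select-pathEdges-adj d (cons a p) [] i lt ()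

module CaterpillarAnalysis {n : ℕ} (E : List (Edge n)) (tree : IsTree n E)
  (vs : List (Fin n)) (spine : IsSpine E vs)
  (proper : ∀ v → Internal E v → ∃[ u ] (Leaf E u × Adj E v u)) where

  open IsTree tree
  open IsSpine spine

  k : ℕ
  k = length vs

  start : Fin n
  start = head-of vs nontrivial

  start∈ : start ∈ vs
  start∈ = head-of-∈ vs nontrivial

  nth : ℕ → Fin n
  nth = nthD start vs

  onSpine : Fin n → Bool
  onSpine u = any (λ v → v == u) vs

  onSpine-∈ : ∀ u → onSpine u ≡ true → u ∈ vs
  onSpine-∈ u e with any-∈ (λ v → v == u) vs e
  ... | v , m , q rewrite ==-true v u q = m

  ∈-onSpine : ∀ {u} → u ∈ vs → onSpine u ≡ true
  ∈-onSpine {u} m = ∈-any (λ v → v == u) m (==-refl u)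

  spine-degree : ∀ {u} → u ∈ vs → 2 ≤ degree E u
  spine-degree {u} = Equivalence.to (internal u)

  off-spine-degree : ∀ u → onSpine u ≡ false → ¬ 2 ≤ degree E u
  off-spine-degree u e le = t≢f (trans (sym (∈-onSpine (Equivalence.from (internal u) le))) e)

  off-spine-neighbour : ∀ u → onSpine u ≡ false → ∃[ w ] (adjB E u w ≡ true)
  off-spine-neighbour u e with connected u start
  ... | here             = ⊥-elim (t≢f (trans (sym (∈-onSpine start∈)) e))
  ... | step {w = w} a _ = w , a

  attach : Fin n → Fin n
  attach u = first (adjB E u) (allFin n) u

  attach-adj : ∀ u → onSpine u ≡ false → adjB E u (attach u) ≡ true
  attach-adj u e with off-spine-neighbour u e
  ... | w , a = proj₂ (first-spec (adjB E u) (allFin n) u (∈-any (adjB E u) (∈-allFin w) a))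

  -- an off-spine vertex has degree < 2, so attach u is its only neighbour
  attach-unique : ∀ u w → onSpine u ≡ false → adjB E u w ≡ true → w ≡ attach u
  attach-unique u w e a with w F.≟ attach u
  ... | yes p = p
  ... | no ne = ⊥-elim (off-spine-degree u e (count-two (adjB E u) (∈-allFin w) (∈-allFin (attach u)) ne a
                                                         (attach-adj u e)))

  -- otherwise {u, attach u} would be a connected component of T
  attach-on-spine : ∀ u → onSpine u ≡ false → onSpine (attach u) ≡ true
  attach-on-spine u e with onSpine (attach u) in e'
  ... | true  = refl
  ... | false = ⊥-elim (start-outside (closed u start (connected u start) (inj₁ refl)))
    where
    back : attach (attach u) ≡ u
    back = sym (attach-unique (attach u) u e' (trans (adj-sym E (attach u) u) (attach-adj u e)))
    closed : ∀ x y → Walk E x y → (x ≡ u ⊎ x ≡ attach u) → (y ≡ u ⊎ y ≡ attach u)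
    closed x .x here h = h
    closed x y (step {w = z} a w) (inj₁ refl) = closed z y w (inj₂ (attach-unique x z e a))
    closed x y (step {w = z} a w) (inj₂ refl) = closed z y w (inj₁ (trans (attach-unique x z e' a) back))
    start-outside : (start ≡ u ⊎ start ≡ attach u) → ⊥
    start-outside (inj₁ p) = t≢f (trans (sym (∈-onSpine start∈)) (trans (cong onSpine p) e))
    start-outside (inj₂ p) = t≢f (trans (sym (∈-onSpine start∈)) (trans (cong onSpine p) e'))

  leafB-off-spine : ∀ u → leafB E u ≡ not (onSpine u)
  leafB-off-spine u with onSpine u in e | degree E u ≟ 1
  ... | true  | yes p = ⊥-elim (<⇒≱ (s≤s (s≤s z≤n)) (≤-trans (spine-degree (onSpine-∈ u e)) (≤-reflexive p)))
  ... | true  | no _  = refl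
  ... | false | yes _ = refl
  ... | false | no ne = ⊥-elim (ne (≤-antisym (≮⇒≥ (off-spine-degree u e))
                                             (count-pos (adjB E u) (∈-allFin (attach u)) (attach-adj u e))))

  leaf-off-spine : ∀ u → Leaf E u → onSpine u ≡ false
  leaf-off-spine u l = trans (sym (not-involutive (onSpine u)))
                             (cong not (trans (sym (leafB-off-spine u)) (leafB-deg l)))
    where
    leafB-deg : ∀ {u} → degree E u ≡ 1 → leafB E u ≡ true
    leafB-deg {u} l with degree E u ≟ 1
    ... | yes _ = refl
    ... | no ne = ⊥-elim (ne l)

  anchor : Fin n → Fin n
  anchor u = if onSpine u then u else attach u

  anchor-on-spine : ∀ u → onSpine (anchor u) ≡ true
  anchor-on-spine u with onSpine u in e
  ... | true  = e
  ... | false = attach-on-spine u e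

  home : Fin n → ℕ
  home u = position vs (anchor u)

  nth-home : ∀ u → nth (home u) ≡ anchor u
  nth-home u = proj₁ (nthD-position start vs (onSpine-∈ _ (anchor-on-spine u)))

  home-< : ∀ u → home u < k
  home-< u = proj₂ (nthD-position start vs (onSpine-∈ _ (anchor-on-spine u)))

  nth-on-spine : ∀ i → i < k → onSpine (nth i) ≡ true
  nth-on-spine i lt = ∈-onSpine (nthD-∈ start vs i lt)

  home-nth : ∀ i → i < k → home (nth i) ≡ i
  home-nth i lt rewrite nth-on-spine i lt = position-nthD start vs distinct i lt

  home-≡ᵇ : ∀ i → i < k → ∀ u → (home u ≡ᵇ i) ≡ (anchor u == nth i)
  home-≡ᵇ i lt u with anchor u F.≟ nth i
  ... | yes p = trans (cong (_≡ᵇ i) (trans (cong (position vs) p) (position-nthD start vs distinct i lt))) (≡ᵇ-refl i)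
  ... | no ne = ≡ᵇ-false _ _ λ q → ne (trans (sym (nth-home u)) (cong nth q))

  anchor-== : ∀ v → onSpine v ≡ true → ∀ u → (anchor u == v) ≡ ((u == v) ∨ (leafB E u ∧ adjB E v u))
  anchor-== v on u rewrite leafB-off-spine u with onSpine u in e
  ... | true  = sym (∨-identityʳ (u == v))
  ... | false with u F.≟ v | attach u F.≟ v
  ... | yes refl | _      = ⊥-elim (t≢f (trans (sym on) e))
  ... | no _     | yes p  = sym (trans (cong (λ z → adjB E z u) (sym p)) (trans (adj-sym E (attach u) u) (attach-adj u e)))
  ... | no _     | no ne  = sym (not-true _ λ a → ne (sym (attach-unique u v e (trans (adj-sym E u v) a))))

  weight : Fin n → ℕ
  weight v = suc (count (λ u → leafB E u ∧ adjB E v u) (allFin n))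

  home-count : ∀ i → i < k → count (λ u → home u ≡ᵇ i) (allFin n) ≡ weight (nth i)
  home-count i lt = begin
    count (λ u → home u ≡ᵇ i) (allFin n)
      ≡⟨ count-cong _ _ (allFin n) (λ u _ → trans (home-≡ᵇ i lt u) (anchor-== (nth i) (nth-on-spine i lt) u)) ⟩
    count (λ u → (u == nth i) ∨ (leafB E u ∧ adjB E (nth i) u)) (allFin n)
      ≡⟨ count-or _ _ (allFin n) disjoint ⟩
    count (λ u → u == nth i) (allFin n) + count (λ u → leafB E u ∧ adjB E (nth i) u) (allFin n)
      ≡⟨ cong (_+ count (λ u → leafB E u ∧ adjB E (nth i) u) (allFin n)) (count-single (λ u → u == nth i) (allFin⁺ n) (∈-allFin (nth i)) (==-refl (nth i))
                        λ y _ q → ==-true y (nth i) q) ⟩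
    weight (nth i) ∎
    where
    open ≡-Reasoning
    disjoint : ∀ u → (u == nth i) ∧ (leafB E u ∧ adjB E (nth i) u) ≡ false
    disjoint u with u F.≟ nth i
    ... | no _  = refl
    ... | yes p rewrite p | leafB-off-spine (nth i) | nth-on-spine i lt = refl

  β : List ℕ
  β = spineComp E vs

  β-length : length β ≡ k
  β-length = length-map weight vs

  β-nth : ∀ i → i < k → nthD 0 β i ≡ weight (nth i)
  β-nth = nthD-map weight start 0 vs

  -- every part of β is at least 2, since every spine vertex has a leaf
  β-≥2 : All (2 ≤_) β
  β-≥2 = All.tabulate λ m → let v , mv , e = ∈-map⁻ weight m in subst (2 ≤_) (sym e) (s≤s (has-leaf v mv))
    where
    has-leaf : ∀ v → v ∈ vs → 1 ≤ count (λ u → leafB E u ∧ adjB E v u) (allFin n)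
    has-leaf v mv with proper v (spine-degree mv)
    ... | u , l , a = count-pos _ (∈-allFin u) (cong₂ _∧_ (trans (leafB-off-spine u) (cong not (leaf-off-spine u l))) a)

  spineEdges : List (Edge n)
  spineEdges = pathEdges path

  spineEdges-length : length spineEdges ≡ k ∸ 1
  spineEdges-length = pathEdges-length path

  spineEdges-unique : Unique spineEdges
  spineEdges-unique = pathEdges-unique path distinct

  spineEdges-on-spine : ∀ {e} → e ∈ spineEdges → onSpine (proj₁ e) ≡ true × onSpine (proj₂ e) ≡ true
  spineEdges-on-spine m = let x , y = pathEdges-ends path m in ∈-onSpine x , ∈-onSpine y

  touchesLeaf : Edge n → Bool
  touchesLeaf e = not (onSpine (proj₁ e)) ∨ not (onSpine (proj₂ e))

  leafEdges : List (Edge n)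
  leafEdges = keep touchesLeaf E

  innerEdges : List (Edge n)
  innerEdges = keep (λ e → not (touchesLeaf e)) E

  leafEdges-unique : Unique leafEdges
  leafEdges-unique = keep-unique touchesLeaf E (simple-unique noMultiEdge)

  leafEdges-⊆ : ∀ {e} → e ∈ leafEdges → e ∈ E
  leafEdges-⊆ m = proj₁ (∈-keep⁻ touchesLeaf E m)

  leafEdge : Fin n → Edge n
  leafEdge u = first (λ e → joins e u (attach u)) E (u , attach u)

  leafEdge-spec : ∀ u → onSpine u ≡ false → leafEdge u ∈ E × joins (leafEdge u) u (attach u) ≡ true
  leafEdge-spec u e = first-spec (λ f → joins f u (attach u)) E (u , attach u) (attach-adj u e)

  leafEdge-∈ : ∀ u → onSpine u ≡ false → leafEdge u ∈ leafEdges
  leafEdge-∈ u e with leafEdge-spec u e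
  ... | m , j with joins-ends (leafEdge u) u (attach u) j
  ... | inj₁ (p , _) = ∈-keep⁺ touchesLeaf m
    (cong (λ b → not b ∨ not (onSpine (proj₂ (leafEdge u)))) (trans (cong onSpine p) e))
  ... | inj₂ (_ , q) = ∈-keep⁺ touchesLeaf m
    (trans (cong (λ b → not (onSpine (proj₁ (leafEdge u))) ∨ not b) (trans (cong onSpine q) e)) (∨-zeroʳ _))

  leafEdges-shape : ∀ {e} → e ∈ leafEdges → ∃[ u ] (onSpine u ≡ false × joins e u (attach u) ≡ true)
  leafEdges-shape {a , b} m with ∈-keep⁻ touchesLeaf E m
  ... | mE , l with onSpine a in ea | onSpine b in eb
  ... | false | _ = a , ea , subst (λ z → joins (a , b) a z ≡ true) (attach-unique a b ea adjab) (joins-self (a , b))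
    where adjab : adjB E a b ≡ true
          adjab = ∈-any (λ e → joins e a b) mE (joins-self (a , b))
  ... | true | false = b , eb , subst (λ z → joins (a , b) b z ≡ true) (attach-unique b a eb adjba)
                                     (trans (joins-sym (a , b) b a) (joins-self (a , b)))
    where adjba : adjB E b a ≡ true
          adjba = trans (adj-sym E b a) (∈-any (λ e → joins e a b) mE (joins-self (a , b)))
  ... | true | true = ⊥-elim (t≢f (sym l))

  spineEdges⊆inner : ∀ {e} → e ∈ spineEdges → e ∈ innerEdges
  spineEdges⊆inner {e} m with spineEdges-on-spine m
  ... | x , y = ∈-keep⁺ _ (pathEdges-⊆ path m) (cong not (cong₂ (λ a b → not a ∨ not b) x y))

  offSpine : List (Fin n)
  offSpine = keep (λ u → not (onSpine u)) (allFin n)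

  offSpine-∉ : ∀ {u} → u ∈ offSpine → onSpine u ≡ false
  offSpine-∉ {u} m with onSpine u | proj₂ (∈-keep⁻ (λ u → not (onSpine u)) (allFin n) m)
  ... | false | _ = refl

  vertex-count : k + length offSpine ≡ n
  vertex-count = begin
    k + length offSpine                                               ≡⟨ cong (_+ length offSpine) (sym spine-count) ⟩
    count onSpine (allFin n) + length offSpine                         ≡⟨ cong (count onSpine (allFin n) +_) (count-keep _ (allFin n)) ⟩
    count onSpine (allFin n) + count (λ u → not (onSpine u)) (allFin n) ≡⟨ count-split onSpine (allFin n) ⟩
    length (allFin n)                                                   ≡⟨ length-tabulate (λ x → x) ⟩
    n                                                                   ∎
    where
    open ≡-Reasoning
    spine-count : count onSpine (allFin n) ≡ k
    spine-count = trans (sym (count-keep onSpine (allFin n)))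
      (↭-length (unique-↭ _ vs (keep-unique onSpine (allFin n) (allFin⁺ n)) distinct
        (λ x m → onSpine-∈ x (proj₂ (∈-keep⁻ onSpine (allFin n) m)))
        (λ x m → ∈-keep⁺ onSpine (∈-allFin x) (∈-onSpine m))))

  -- distinct leaves have distinct leaf edges, so there are at least as many
  -- leaf edges as leaves
  offSpine≤leafEdges : length offSpine ≤ length leafEdges
  offSpine≤leafEdges = subst (_≤ length leafEdges) (length-map leafEdge offSpine)
    (unique-⊆-length (map leafEdge offSpine) leafEdges
      (map-unique leafEdge offSpine (keep-unique _ (allFin n) (allFin⁺ n)) injective)
      λ x m → let u , mu , eq = ∈-map⁻ leafEdge m in subst (_∈ leafEdges) (sym eq) (leafEdge-∈ u (offSpine-∉ mu)))
    where
    injective : ∀ u w → u ∈ offSpine → w ∈ offSpine → leafEdge u ≡ leafEdge w → u ≡ w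
    injective u w mu mw eq with joins-same (leafEdge u) (proj₂ (leafEdge-spec u (offSpine-∉ mu)))
                                  (subst (λ z → joins z w (attach w) ≡ true) (sym eq) (proj₂ (leafEdge-spec w (offSpine-∉ mw))))
    ... | inj₁ (p , _) = p
    ... | inj₂ (p , _) = ⊥-elim (t≢f (trans (sym (attach-on-spine w (offSpine-∉ mw)))
                                             (trans (cong onSpine (sym p)) (offSpine-∉ mu))))

  open import Data.List.Membership.DecPropositional (≡-dec (F._≟_ {n}) (F._≟_ {n}))
    using () renaming (_∈?_ to _∈Edge?_)

  -- if an inner edge were not a spine edge, T would have at least n edges
  inner⊆spineEdges : ∀ {e} → e ∈ innerEdges → e ∈ spineEdges
  inner⊆spineEdges {e} m with e ∈Edge? spineEdges
  ... | yes p = p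
  ... | no np = ⊥-elim (<-irrefl refl too-many)
    where
    k≤inner : k ≤ length innerEdges
    k≤inner = subst (_≤ length innerEdges)
      (trans (cong suc spineEdges-length) (m+[n∸m]≡n {1} {k} (≤-trans (s≤s z≤n) nontrivial)))
      (unique-⊂-length spineEdges innerEdges spineEdges-unique (λ x → spineEdges⊆inner) m np)
    too-many : n < n
    too-many = begin-strict
      n                                        ≡⟨ sym vertex-count ⟩
      k + length offSpine                      ≤⟨ +-mono-≤ k≤inner offSpine≤leafEdges ⟩
      length innerEdges + length leafEdges     ≡⟨ +-comm (length innerEdges) _ ⟩
      length leafEdges + length innerEdges     ≡⟨ cong₂ _+_ (count-keep touchesLeaf E) (count-keep _ E) ⟩
      count touchesLeaf E + count (λ e → not (touchesLeaf e)) E ≡⟨ count-split touchesLeaf E ⟩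
      length E                                 <⟨ n<1+n _ ⟩
      suc (length E)                           ≡⟨ edgeCount ⟩
      n                                        ∎
      where open ≤-Reasoning

  edges-split : E ↭ spineEdges ++ leafEdges
  edges-split = ↭-trans (↭-sym (keep-↭ touchesLeaf E))
    (↭-trans (++-comm leafEdges innerEdges)
      (++⁺ʳ leafEdges (unique-↭ innerEdges spineEdges (keep-unique _ E (simple-unique noMultiEdge)) spineEdges-unique
                         (λ x → inner⊆spineEdges) (λ x → spineEdges⊆inner))))

  -- a proper caterpillar has a leaf, so the spine is not everything
  k<n : k < n
  k<n with proper start (spine-degree start∈)
  ... | u , l , _ = subst (k <_) vertex-count (m<m+n k (subst (0 <_) (sym (count-keep _ (allFin n)))
                      (count-pos (λ u → not (onSpine u)) (∈-allFin u) (cong not (leaf-off-spine u l)))))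

  anchor-attach : ∀ u → onSpine u ≡ false → anchor u ≡ anchor (attach u)
  anchor-attach u e rewrite e | attach-on-spine u e = refl

  -- The components of A = (spine edges selected by c) ∪ (all leaf edges):
  -- u and w are connected iff their homes lie in the same block of c.
  module AllLeafEdges (c : List Bool) (c-length : length c ≡ k ∸ 1) where

    A : List (Edge n)
    A = select spineEdges c ++ leafEdges

    k≡ : k ≡ suc (length c)
    k≡ = trans (sym (m+[n∸m]≡n {1} {k} (≤-trans (s≤s z≤n) nontrivial))) (cong suc (sym c-length))

    ≤length-c : ∀ {j} → j < k → j ≤ length c
    ≤length-c lt = ≤-pred (subst (_ <_) k≡ lt)

    label : Fin n → ℕ
    label u = block c (home u)

    label-edge : ∀ x y → adjB A x y ≡ true → label x ≡ label y
    label-edge x y a with adj-∈ A x y a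
    ... | e , m , j with ∈-++⁻ (select spineEdges c) m
    ... | inj₂ mL with leafEdges-shape mL
    ...   | u , off , ju with joins-same e j ju
    ...     | inj₁ (refl , refl) = cong (block c ∘ position vs) (anchor-attach u off)
    ...     | inj₂ (refl , refl) = cong (block c ∘ position vs) (sym (anchor-attach u off))
    label-edge x y a | e , m , j | inj₁ mS with pathEdges-select start path c mS
    ... | i , lt , l , ji with joins-same e j ji
    ...   | inj₁ (refl , refl) = trans (cong (block c) (home-nth i (≤-trans (n≤1+n (suc i)) lt)))
                                   (trans (sym same-block) (cong (block c) (sym (home-nth (suc i) lt))))
      where same-block = block-merged c i (≤length-c lt) l
    ...   | inj₂ (refl , refl) = trans (cong (block c) (home-nth (suc i) lt))
                                   (trans same-block (cong (block c) (sym (home-nth i (≤-trans (n≤1+n (suc i)) lt)))))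
      where same-block = block-merged c i (≤length-c lt) l

    leafEdge-adj : ∀ u → onSpine u ≡ false → adjB A u (attach u) ≡ true
    leafEdge-adj u e = ∈-any (λ f → joins f u (attach u)) (∈-++⁺ʳ (select spineEdges c) (leafEdge-∈ u e))
                             (proj₂ (leafEdge-spec u e))

    to-anchor : ∀ u → Reach A u (anchor u) 1
    to-anchor u with onSpine u in e
    ... | true  = reach-mono A {u} {u} {0} {1} z≤n (reach-refl A u)
    ... | false = reach-edge A (leafEdge-adj u e)

    from-anchor : ∀ u → Reach A (anchor u) u 1
    from-anchor u with onSpine u in e
    ... | true  = reach-mono A {u} {u} {0} {1} z≤n (reach-refl A u)
    ... | false = reach-edge A (trans (adj-sym A (attach u) u) (leafEdge-adj u e))

    spine-adj : ∀ j → suc j < k → merged c j ≡ true → adjB A (nth j) (nth (suc j)) ≡ true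
    spine-adj j lt l with adj-∈ (select spineEdges c) (nth j) (nth (suc j)) (select-pathEdges-adj start path c j lt l)
    ... | e , m , je = ∈-any (λ e → joins e (nth j) (nth (suc j))) (∈-++⁺ˡ m) je

    last-gap : ∀ i j → i ≤ j → suc j < k → block c i ≡ block c (suc j) → block c i ≡ block c j × merged c j ≡ true
    last-gap i j le lt e =
      ≤-antisym (block-mono c i j le (≤-trans (n≤1+n j) (≤length-c lt)))
                (≤-trans (block-mono c j (suc j) (n≤1+n j) (≤length-c lt)) (≤-reflexive (sym e)))
      , block-eq⇒merged c i (suc j) j le ≤-refl (≤length-c lt) e

    block-forward : ∀ i j → i ≤ j → j < k → block c i ≡ block c j → Reach A (nth i) (nth j) j
    block-forward i j le lt e with m≤n⇒m<n∨m≡n le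
    ... | inj₂ refl = reach-mono A {nth i} {nth i} {0} {i} z≤n (reach-refl A (nth i))
    block-forward i (suc j) le lt e | inj₁ (s≤s i≤j) with last-gap i j i≤j lt e
    ... | e' , l = reach-step A {nth i} {nth j} {nth (suc j)} {j} (block-forward i j i≤j (≤-trans (n≤1+n _) lt) e') (spine-adj j lt l)

    block-backward : ∀ i j → i ≤ j → j < k → block c i ≡ block c j → Reach A (nth j) (nth i) j
    block-backward i j le lt e with m≤n⇒m<n∨m≡n le
    ... | inj₂ refl = reach-mono A {nth i} {nth i} {0} {i} z≤n (reach-refl A (nth i))
    block-backward i (suc j) le lt e | inj₁ (s≤s i≤j) with last-gap i j i≤j lt e
    ... | e' , l = subst (Reach A (nth (suc j)) (nth i)) (+-comm j 1)
                     (reach-trans A 1 j (reach-edge A (trans (adj-sym A (nth (suc j)) (nth j)) (spine-adj j lt l)))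
                                        (block-backward i j i≤j (≤-trans (n≤1+n _) lt) e'))

    -- u → anchor u → ⋯ → anchor w → w takes at most m + 2 ≤ k + 1 ≤ n rounds
    via-anchors : ∀ u w m → m < k → Reach A (nth (home u)) (nth (home w)) m → comp A u w ≡ true
    via-anchors u w m lt r = reach-mono A bound
      (reach-trans A (m + 1) 1
        (reach-trans A 1 m (subst (λ z → Reach A u z 1) (sym (nth-home u)) (to-anchor u)) r)
        (subst (λ z → Reach A z w 1) (sym (nth-home w)) (from-anchor w)))
      where
      bound : 1 + (m + 1) ≤ n
      bound = ≤-trans (s≤s (≤-reflexive (+-comm m 1))) (≤-trans (s≤s lt) k<n)

    same-label⇒comp : ∀ u w → label u ≡ label w → comp A u w ≡ true
    same-label⇒comp u w e with ≤-total (home u) (home w)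
    ... | inj₁ le = via-anchors u w (home w) (home-< w) (block-forward (home u) (home w) le (home-< w) e)
    ... | inj₂ le = via-anchors u w (home u) (home-< u) (block-backward (home w) (home u) le (home-< u) (sym e))

    comp≡label : ∀ v u → comp A v u ≡ (label u ≡ᵇ label v)
    comp≡label v u with comp A v u in e
    ... | true  = sym (trans (cong (_≡ᵇ label v) (comp-label A label label-edge v u e)) (≡ᵇ-refl (label v)))
    ... | false = sym (≡ᵇ-false _ _ λ q → t≢f (trans (sym (same-label⇒comp v u (sym q))) e))

    label-onto : ∀ j → j < suc (cuts c) → ∃[ u ] (label u ≡ j)
    label-onto j lt with block-onto c j lt
    ... | i , li , e = nth i , trans (cong (block c) (home-nth i (subst (i <_) (sym k≡) li))) e

    open ComponentLabelling A label (suc (cuts c)) comp≡label (λ u → s≤s (block-≤-cuts c (home u))) label-onto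

    classSize-block : ∀ j → classSize j ≡ sumTo (suc (length c)) (λ i → if block c i ≡ᵇ j then nthD 0 β i else 0)
    classSize-block j = begin
      count (λ u → block c (home u) ≡ᵇ j) (allFin n)
        ≡⟨ count-fibres home k (λ i → block c i ≡ᵇ j) (allFin n) (λ x _ → home-< x) ⟩
      sumTo k (λ i → if block c i ≡ᵇ j then count (λ u → home u ≡ᵇ i) (allFin n) else 0)
        ≡⟨ sumTo-cong k _ _ (λ i lt → cong (λ z → if block c i ≡ᵇ j then z else 0)
                                          (trans (home-count i lt) (sym (β-nth i lt)))) ⟩
      sumTo k (λ i → if block c i ≡ᵇ j then nthD 0 β i else 0)
        ≡⟨ cong (λ r → sumTo r (λ i → if block c i ≡ᵇ j then nthD 0 β i else 0)) k≡ ⟩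
      sumTo (suc (length c)) (λ i → if block c i ≡ᵇ j then nthD 0 β i else 0) ∎
      where open ≡-Reasoning

    partition-coarsen : partitionOf A ↭ coarsen β c
    partition-coarsen = ↭-trans partition-labels (↭-reflexive (begin
      map classSize (upTo (suc (cuts c)))
        ≡⟨ map-applyUpTo (λ x → x) classSize (suc (cuts c)) ⟩
      applyUpTo classSize (suc (cuts c))
        ≡⟨ applyUpTo-cong (suc (cuts c)) classSize-block ⟩
      applyUpTo (λ j → sumTo (suc (length c)) (λ i → if block c i ≡ᵇ j then nthD 0 β i else 0)) (suc (cuts c))
        ≡⟨ block-sums c (nthD 0 β) ⟩
      coarsen (applyUpTo (nthD 0 β) (suc (length c))) c
        ≡⟨ cong (λ r → coarsen (applyUpTo (nthD 0 β) r) c) (sym (trans β-length k≡)) ⟩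
      coarsen (applyUpTo (nthD 0 β) (length β)) c
        ≡⟨ cong (λ z → coarsen z c) (sym (applyUpTo-nthD β)) ⟩
      coarsen β c ∎))
      where open ≡-Reasoning

  -- If A consists of spine edges and some leaf edges but misses the edge of
  -- the leaf u, then u is isolated in (V, A) and λ(A) has a part 1.
  missing-leaf-edge : ∀ (s l : List (Edge n)) → (∀ {e} → e ∈ s → e ∈ spineEdges) → (∀ {e} → e ∈ l → e ∈ leafEdges) →
                      ∀ {x} → x ∈ leafEdges → x ∉ l → 1 ∈ partitionOf (s ++ l)
  missing-leaf-edge s l s⊆ l⊆ {x} mx x∉ with leafEdges-shape mx
  ... | u , off , jx = isolated-part (s ++ l) u λ w → not-true _ λ a → no-edge w (adj-∈ (s ++ l) u w a)
    where
    no-edge : ∀ w → ∃[ e ] (e ∈ s ++ l × joins e u w ≡ true) → ⊥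
    no-edge w (e , m , j) with ∈-++⁻ s m
    ... | inj₁ ms with spineEdges-on-spine (s⊆ ms) | joins-ends e u w j
    ...   | p , _ | inj₁ (q , _) = t≢f (trans (sym p) (trans (cong onSpine q) off))
    ...   | _ , p | inj₂ (_ , q) = t≢f (trans (sym p) (trans (cong onSpine q) off))
    no-edge w (e , m , j) | inj₂ ml = x∉ (subst (_∈ l) same ml)
      where
      eE = leafEdges-⊆ (l⊆ ml)
      w≡ : w ≡ attach u
      w≡ = attach-unique u w off (∈-any (λ f → joins f u w) eE j)
      same : e ≡ x
      same = simple-same-ends noMultiEdge eE (leafEdges-⊆ mx) (subst (λ z → joins e u z ≡ true) w≡ j) jx

  private
    C : List (List Bool)
    C = choices (length spineEdges)

    C-length : ∀ {c} → c ∈ C → length c ≡ k ∸ 1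
    C-length m = trans (choices-length (length spineEdges) m) spineEdges-length

    withLeaves : List (Edge n) → List (List (Edge n))
    withLeaves s = map (s ++_) (subsets leafEdges)

    full : List Bool → List (Edge n)
    full c = select spineEdges c ++ leafEdges

    -- among the subsets with spine part selected by c only the one
    -- containing every leaf edge survives
    survivors : ∀ c → c ∈ C → withoutUnit (map partitionOf (withLeaves (select spineEdges c))) ≡ partitionOf (full c) ∷ []
    survivors c mc = begin
      withoutUnit (map partitionOf (map (select spineEdges c ++_) (subsets leafEdges)))
        ≡⟨ cong (λ L → withoutUnit (map partitionOf (map (select spineEdges c ++_) L))) (subsets-whole leafEdges) ⟩
      withoutUnit (partitionOf (full c) ∷ map partitionOf (map (select spineEdges c ++_) (properSubsets leafEdges)))
        ≡⟨ filter-accept noUnitPart? no-unit ⟩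
      partitionOf (full c) ∷ withoutUnit (map partitionOf (map (select spineEdges c ++_) (properSubsets leafEdges)))
        ≡⟨ cong (partitionOf (full c) ∷_) (filter-none noUnitPart? (All.tabulate has-unit)) ⟩
      partitionOf (full c) ∷ [] ∎
      where
      open ≡-Reasoning
      open AllLeafEdges c (C-length mc)
      no-unit : NoUnitPart (partitionOf (full c))
      no-unit 1∈ = <⇒≱ (s≤s (s≤s z≤n)) (All.lookup (coarsen-≥ β c β-≥2) (∈-resp-↭ partition-coarsen 1∈))
      has-unit : ∀ {m} → m ∈ map partitionOf (map (select spineEdges c ++_) (properSubsets leafEdges)) → ¬ NoUnitPart m
      has-unit m 1∉ with ∈-map⁻ partitionOf m
      ... | A , mA , refl with ∈-map⁻ (select spineEdges c ++_) mA
      ... | l , ml , refl with properSubsets-miss leafEdges leafEdges-unique ml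
      ... | x , mx , x∉ = 1∉ (missing-leaf-edge (select spineEdges c) l (select-⊆ spineEdges c)
                             (subsets-⊆ leafEdges (subst (l ∈_) (sym (subsets-whole leafEdges)) (there ml))) mx x∉)

    survivors-all : ∀ C' → (∀ {c} → c ∈ C' → c ∈ C) →
      withoutUnit (map partitionOf (concatMap withLeaves (map (select spineEdges) C'))) ≡ map (partitionOf ∘ full) C'
    survivors-all []       h = refl
    survivors-all (c ∷ C') h =
      trans (cong withoutUnit (map-++ partitionOf (withLeaves (select spineEdges c)) _))
       (trans (filter-++ noUnitPart? (map partitionOf (withLeaves (select spineEdges c))) _)
         (cong₂ _++_ (survivors c (h (here refl))) (survivors-all C' (λ m → h (there m)))))

    full-coarsen : ∀ C' → (∀ {c} → c ∈ C' → c ∈ C) → Pointwise _↭_ (map (partitionOf ∘ full) C') (map (coarsen β) C')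
    full-coarsen []       h = []
    full-coarsen (c ∷ C') h = AllLeafEdges.partition-coarsen c (C-length (h (here refl))) ∷ full-coarsen C' (λ m → h (there m))

  withoutUnit-U : withoutUnit (U E) ≈P Lpoly β
  withoutUnit-U = begin
    withoutUnit (map partitionOf (subsets E))
      ↭⟨ withoutUnit-≈ (↭⇒≈P (subsets-↭ partitionOf partition-↭ edges-split)) ⟩
    withoutUnit (map partitionOf (subsets (spineEdges ++ leafEdges)))
      ≡⟨ cong (withoutUnit ∘ map partitionOf) (trans (subsets-++ spineEdges leafEdges)
                                                     (cong (concatMap withLeaves) (subsets-select spineEdges))) ⟩
    withoutUnit (map partitionOf (concatMap withLeaves (map (select spineEdges) C)))
      ≡⟨ survivors-all C (λ m → m) ⟩
    map (partitionOf ∘ full) C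
      ≋⟨ full-coarsen C (λ m → m) ⟩
    map (coarsen β) C
      ≡⟨ cong (λ r → map (coarsen β) (choices r)) (trans spineEdges-length (sym (cong (_∸ 1) β-length))) ⟩
    map (coarsen β) (choices (length β ∸ 1))
      ↭⟨ ↭⇒≈P (↭-sym (coarsenings-choices β (subst (1 ≤_) (sym β-length) (≤-trans (s≤s z≤n) nontrivial)))) ⟩
    coarsenings β ∎
    where
    open PermS.PermutationReasoning ↭-setoid

corollary2p4 : ∀ {n n′} (E : List (Edge n)) (E′ : List (Edge n′))
    → ProperCaterpillar E → ProperCaterpillar E′
    → U E ≈P U E′
    → ∀ (β β′ : List ℕ) → Φ E β → Φ E′ β′
    → Lpoly β ≈P Lpoly β′
corollary2p4 E E′ ((tree , _) , proper) ((tree′ , _) , proper′) U≈U′ β β′ (vs , spine , refl) (vs′ , spine′ , refl) =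
  begin
    Lpoly (spineComp E vs)     ↭⟨ CaterpillarAnalysis.withoutUnit-U E tree vs spine proper ⟨
    withoutUnit (U E)          ↭⟨ withoutUnit-≈ U≈U′ ⟩
    withoutUnit (U E′)         ↭⟨ CaterpillarAnalysis.withoutUnit-U E′ tree′ vs′ spine′ proper′ ⟩
    Lpoly (spineComp E′ vs′)   ∎
  where open PermS.PermutationReasoning ↭-setoid
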